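{- Let $F(z)=\sum_{n\ge 0} I_n z^n$, where $I_n$ is the number of inversion sequences of length $n$ avoiding each of the patterns $100$, $102$ and $201$ (equivalently, the number of inversion sequences $(a_1,\dots,a_n)$ with no indices $i<j<k$ such that $a_i>a_j$, $a_j\le a_k$ and $a_i\ne a_k$), with $I_0=1$. Then \[ F(z)=\frac{2+z-10z^2+4z^3-(2-3z)\sqrt{1-4z-4z^2}}{8z(1-z)^2}. \]
   Context: An inversion sequence of length $n$ is an integer sequence $(a_1,\dots,a_n)$ with $0\le a_i<i$ for all $i$. A pattern is a sequence of non-negative integers containing every value from $0$ to its maximum. The reduction of a sequence of non-negative integers replaces its smallest entries by $0$, the next smallest by $1$, and so on. A sequence $a$ contains a pattern $\sigma$ of length $k$ if some (not necessarily consecutive) subsequence $a_{i_1}\cdots a_{i_k}$, $i_1<\dots<i_k$, has reduction $\sigma$; otherwise it avoids $\sigma$. The empty sequence is the unique inversion sequence of length $0$. -}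

module Defs where

open import Data.Nat as ℕ using (ℕ; zero; suc; _∸_; _<?_)
open import Data.Nat.Properties as ℕP using ()
open import Data.Integer as ℤ using (ℤ; +_)
open import Data.List using (List; []; _∷_; _++_; [_]; map; filter; length; foldr; upTo; concatMap; deduplicate)
open import Data.Bool.ListAction using (any)
open import Data.List.Properties using (≡-dec)
open import Data.Bool using (Bool; true; false; _∧_; not)
open import Relation.Nullary using (does)

invSeqs : ℕ → List (List ℕ)
invSeqs zero    = [] ∷ []
invSeqs (suc n) = concatMap (λ a → map (λ x → a ++ [ x ]) (upTo (suc n))) (invSeqs n)

subseqs : {A : Set} → ℕ → List A → List (List A)
subseqs zero    _        = [] ∷ []
subseqs (suc k) []       = []
subseqs (suc k) (x ∷ xs) = map (x ∷_) (subseqs k xs) ++ subseqs (suc k) xs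

reduction : List ℕ → List ℕ
reduction s = map (λ x → length (deduplicate ℕ._≟_ (filter (_<? x) s))) s

eqList : List ℕ → List ℕ → Bool
eqList u v = does (≡-dec ℕ._≟_ u v)

contains : List ℕ → List ℕ → Bool
contains a σ = any (λ t → eqList (reduction t) σ) (subseqs (length σ) a)

avoids : List ℕ → List ℕ → Bool
avoids a σ = not (contains a σ)

p100 p102 p201 : List ℕ
p100 = 1 ∷ 0 ∷ 0 ∷ []
p102 = 1 ∷ 0 ∷ 2 ∷ []
p201 = 2 ∷ 0 ∷ 1 ∷ []

avoidsAll : List ℕ → Bool
avoidsAll a = avoids a p100 ∧ avoids a p102 ∧ avoids a p201

I : ℕ → ℕ
I n = length (filter (λ a → avoidsAll a Data.Bool.≟ true) (invSeqs n))

-- Formal power series over ℤ, as coefficient sequences ℕ → ℤ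

sumℤ : List ℤ → ℤ
sumℤ = foldr ℤ._+_ (+ 0)

_⊛_ : (ℕ → ℤ) → (ℕ → ℤ) → ℕ → ℤ
(f ⊛ g) n = sumℤ (map (λ i → f i ℤ.* g (n ∸ i)) (upTo (suc n)))

-- polynomial with given coefficient list (constant term first)
poly : List ℤ → ℕ → ℤ
poly []       _       = + 0
poly (c ∷ cs) zero    = c
poly (c ∷ cs) (suc n) = poly cs n

F : ℕ → ℤ
F n = + I n

-- An avoiding sequence is read from left to right by a small automaton: while it is weakly
-- increasing only its maximum L and its largest smaller entry σ matter, and after the first
-- descent, to x say, the rest must either decrease strictly (x < σ) or use only values below x
-- and repeats of the maximum (x ≥ σ). These two kinds of states have the generating functions
-- (1+X)^x and (1+X)^x/(1-X), so F is governed by the pairs (L, σ) of the weakly increasing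
-- prefixes of each length m. The sums of t^L, t^σ and (m-L)·t^L over these pairs obey simple
-- recursions in m; summed against Xᵐ (at t = 1+X: the series P, Q, B) they give linear
-- equations between F, P, Q, B and g = C(X(1+X)), where C m counts the pairs of length m.
-- At t = 1-X the first recursion degenerates to (1-X)·C(X(1-X)) = 1, which forces the Catalan
-- recursion for C and hence g = 1 + X(1+X)g². Then S = 1 - 2X(1+X)g satisfies
-- S² = 1-4X-4X², and eliminating P, Q and B expresses 8X(1-X)²F through S.

module Submission where

open import Defs
open import Data.Nat using (ℕ)
open import Data.Integer using (ℤ; +_; -_; _-_)
open import Data.List using (List; []; _∷_)
open import Data.Product using (Σ; _×_)
open import Relation.Binary.PropositionalEquality using (_≡_)

module Comparisons where

  open import Data.Nat using (_<_; _≤_; _≟_; _<?_; _<ᵇ_; _≡ᵇ_)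
  open import Data.Nat.Properties using (≤⇒≯; <ᵇ⇒<)
  open import Data.Bool using (true; false; T)
  open import Relation.Binary.PropositionalEquality using (_≡_; refl; subst; sym)
  open import Relation.Nullary using (¬_)
  open import Relation.Nullary.Decidable using (dec-true; dec-false)

  <ᵇ-true : ∀ {m n} → m < n → (m <ᵇ n) ≡ true
  <ᵇ-true {m} {n} = dec-true (m <? n)

  <ᵇ-false : ∀ {m n} → n ≤ m → (m <ᵇ n) ≡ false
  <ᵇ-false {m} {n} n≤m = dec-false (m <? n) (≤⇒≯ n≤m)

  ≡ᵇ-refl : ∀ n → (n ≡ᵇ n) ≡ true
  ≡ᵇ-refl n = dec-true (n ≟ n) refl

  ≡ᵇ-false : ∀ {m n} → ¬ m ≡ n → (m ≡ᵇ n) ≡ false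
  ≡ᵇ-false {m} {n} = dec-false (m ≟ n)

  <ᵇ-sound : ∀ {m n} → (m <ᵇ n) ≡ true → m < n
  <ᵇ-sound {m} {n} m<ᵇn = <ᵇ⇒< m n (subst T (sym m<ᵇn) _)

module PowerSeries where

  open Comparisons
  open import Data.Nat as ℕ using (ℕ; zero; suc; _∸_; _<ᵇ_; _≡ᵇ_)
  import Data.Nat.Properties as ℕP
  open import Data.Integer as ℤ using (ℤ; +_; -_; _+_; _*_)
  import Data.Integer.Properties as ℤP
  open import Data.Integer.Solver using (module +-*-Solver)
  open import Data.Maybe using (Maybe; just; nothing)
  open import Data.Product using (_×_; _,_)
  open import Data.List using (List; []; _∷_; _++_; concatMap; applyUpTo; length)
  open import Data.List.Relation.Unary.All using (All; []; _∷_)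
  open import Function using (_∘_)
  open import Data.Bool using (Bool; if_then_else_)
  open import Relation.Nullary using (¬_; yes; no)
  open import Relation.Binary.PropositionalEquality
  open import Algebra.Bundles using (CommutativeRing)
  open import Algebra.Structures using (IsCommutativeRing)
  import Algebra.Solver.Ring
  open import Algebra.Solver.Ring.AlmostCommutativeRing
    using (AlmostCommutativeRing; fromCommutativeRing; _-Raw-AlmostCommutative⟶_)

  sumTo : ℕ → (ℕ → ℤ) → ℤ
  sumTo zero    f = + 0
  sumTo (suc n) f = f 0 + sumTo n (f ∘ suc)

  sumTo-cong : ∀ n {f g : ℕ → ℤ} → (∀ i → i ℕ.< n → f i ≡ g i) → sumTo n f ≡ sumTo n g
  sumTo-cong zero    f≡g = refl
  sumTo-cong (suc n) f≡g = cong₂ _+_ (f≡g 0 ℕ.z<s) (sumTo-cong n (λ i i<n → f≡g (suc i) (ℕ.s<s i<n)))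

  sumTo-+ : ∀ n (f g : ℕ → ℤ) → sumTo n (λ i → f i + g i) ≡ sumTo n f + sumTo n g
  sumTo-+ zero    f g = refl
  sumTo-+ (suc n) f g = begin
    (f 0 + g 0) + sumTo n (λ i → f (suc i) + g (suc i))
      ≡⟨ cong (λ t → (f 0 + g 0) + t) (sumTo-+ n (f ∘ suc) (g ∘ suc)) ⟩
    (f 0 + g 0) + (sumTo n (f ∘ suc) + sumTo n (g ∘ suc))
      ≡⟨ solve 4 (λ a b c d → (a :+ b) :+ (c :+ d) := (a :+ c) :+ (b :+ d)) refl (f 0) (g 0) _ _ ⟩
    (f 0 + sumTo n (f ∘ suc)) + (g 0 + sumTo n (g ∘ suc)) ∎
    where open ≡-Reasoning
          open +-*-Solver

  sumTo-*ˡ : ∀ n c (f : ℕ → ℤ) → sumTo n (λ i → c * f i) ≡ c * sumTo n f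
  sumTo-*ˡ zero    c f = sym (ℤP.*-zeroʳ c)
  sumTo-*ˡ (suc n) c f = trans (cong (λ t → c * f 0 + t) (sumTo-*ˡ n c (f ∘ suc))) (sym (ℤP.*-distribˡ-+ c (f 0) _))

  sumTo-neg : ∀ n (f : ℕ → ℤ) → sumTo n (λ i → - f i) ≡ - sumTo n f
  sumTo-neg n f = trans (sumTo-cong n (λ i _ → sym (ℤP.-1*i≡-i (f i)))) (trans (sumTo-*ˡ n (- + 1) f) (ℤP.-1*i≡-i _))

  sumTo-zero : ∀ n → sumTo n (λ _ → + 0) ≡ + 0
  sumTo-zero zero    = refl
  sumTo-zero (suc n) = trans (ℤP.+-identityˡ _) (sumTo-zero n)

  Series : Set
  Series = ℕ → ℤ

  infix 4 _≋_
  _≋_ : Series → Series → Set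
  f ≋ g = ∀ n → f n ≡ g n

  ≋-refl : ∀ {f} → f ≋ f
  ≋-refl _ = refl

  ≋-sym : ∀ {f g} → f ≋ g → g ≋ f
  ≋-sym f≋g n = sym (f≋g n)

  ≋-trans : ∀ {f g h} → f ≋ g → g ≋ h → f ≋ h
  ≋-trans f≋g g≋h n = trans (f≋g n) (g≋h n)

  infixl 6 _⊕_
  infixl 7 _⊗_

  _⊕_ : Series → Series → Series
  (f ⊕ g) n = f n + g n

  ⊝_ : Series → Series
  (⊝ f) n = - f n

  _⊗_ : Series → Series → Series
  (f ⊗ g) n = sumTo (suc n) (λ i → f i * g (n ∸ i))

  κ : ℤ → Series
  κ c zero    = c
  κ c (suc n) = + 0

  𝟘 𝟙 X : Series
  𝟘 _ = + 0
  𝟙 = κ (+ 1)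
  X zero          = + 0
  X (suc zero)    = + 1
  X (suc (suc n)) = + 0

  infixr 8 _·_
  _·_ : ℤ → Series → Series
  (c · f) n = c * f n

  ⊗-cong : ∀ {f f′ g g′} → f ≋ f′ → g ≋ g′ → f ⊗ g ≋ f′ ⊗ g′
  ⊗-cong f≋f′ g≋g′ n = sumTo-cong (suc n) (λ i _ → cong₂ _*_ (f≋f′ i) (g≋g′ (n ∸ i)))

  ⊗-distribʳ-⊕ : ∀ f g h → (g ⊕ h) ⊗ f ≋ g ⊗ f ⊕ h ⊗ f
  ⊗-distribʳ-⊕ f g h n = trans (sumTo-cong (suc n) (λ i _ → ℤP.*-distribʳ-+ (f (n ∸ i)) (g i) (h i)))
                               (sumTo-+ (suc n) (λ i → g i * f (n ∸ i)) (λ i → h i * f (n ∸ i)))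

  ⊗-distribˡ-⊕ : ∀ f g h → f ⊗ (g ⊕ h) ≋ f ⊗ g ⊕ f ⊗ h
  ⊗-distribˡ-⊕ f g h n = trans (sumTo-cong (suc n) (λ i _ → ℤP.*-distribˡ-+ (f i) (g (n ∸ i)) (h (n ∸ i))))
                               (sumTo-+ (suc n) (λ i → f i * g (n ∸ i)) (λ i → f i * h (n ∸ i)))

  κ⊗ : ∀ c f → κ c ⊗ f ≋ c · f
  κ⊗ c f zero    = ℤP.+-identityʳ (c * f 0)
  κ⊗ c f (suc n) = trans (cong (λ t → c * f (suc n) + t)
                               (trans (sumTo-cong (suc n) (λ i _ → ℤP.*-zeroˡ (f (n ∸ i)))) (sumTo-zero (suc n))))
                         (ℤP.+-identityʳ (c * f (suc n)))

  ⊗-identityˡ : ∀ f → 𝟙 ⊗ f ≋ f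
  ⊗-identityˡ f n = trans (κ⊗ (+ 1) f n) (ℤP.*-identityˡ (f n))

  -- The definition of ⊗ peels off f₀; this peels off g₀ instead.
  ⊗-sucʳ : ∀ f g n → (f ⊗ g) (suc n) ≡ (f ⊗ (g ∘ suc)) n + f (suc n) * g 0
  ⊗-sucʳ f g zero    = solve 4 (λ a b c d → a :* b :+ (c :* d :+ con (+ 0)) := (a :* b :+ con (+ 0)) :+ c :* d)
                             refl (f 0) (g 1) (f 1) (g 0)
    where open +-*-Solver
  ⊗-sucʳ f g (suc n) = trans (cong (λ t → f 0 * g (suc (suc n)) + t) (⊗-sucʳ (f ∘ suc) g n))
                             (sym (ℤP.+-assoc (f 0 * g (suc (suc n))) (((f ∘ suc) ⊗ (g ∘ suc)) n) (f (suc (suc n)) * g 0)))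

  ⊗-comm : ∀ f g → f ⊗ g ≋ g ⊗ f
  ⊗-comm f g zero    = cong (ℤ._+ + 0) (ℤP.*-comm (f 0) (g 0))
  ⊗-comm f g (suc n) = begin
    f 0 * g (suc n) + ((f ∘ suc) ⊗ g) n   ≡⟨ cong₂ _+_ (ℤP.*-comm (f 0) _) (⊗-comm (f ∘ suc) g n) ⟩
    g (suc n) * f 0 + (g ⊗ (f ∘ suc)) n   ≡⟨ ℤP.+-comm (g (suc n) * f 0) ((g ⊗ (f ∘ suc)) n) ⟩
    (g ⊗ (f ∘ suc)) n + g (suc n) * f 0   ≡⟨ sym (⊗-sucʳ g f n) ⟩
    (g ⊗ f) (suc n)                          ∎
    where open ≡-Reasoning

  ·-⊗ : ∀ c f g → (c · f) ⊗ g ≋ c · (f ⊗ g)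
  ·-⊗ c f g n = trans (sumTo-cong (suc n) (λ i _ → ℤP.*-assoc c (f i) (g (n ∸ i))))
                      (sumTo-*ˡ (suc n) c (λ i → f i * g (n ∸ i)))

  -- ((f ⊗ g) ∘ suc) is definitionally  f₀ · (g ∘ suc) ⊕ (f ∘ suc) ⊗ g.
  ⊗-assoc : ∀ f g h → (f ⊗ g) ⊗ h ≋ f ⊗ (g ⊗ h)
  ⊗-assoc f g h zero    = solve 3 (λ a b c → (a :* b :+ con (+ 0)) :* c :+ con (+ 0) := a :* (b :* c :+ con (+ 0)) :+ con (+ 0))
                                refl (f 0) (g 0) (h 0)
    where open +-*-Solver
  ⊗-assoc f g h (suc n) = begin
    (f ⊗ g) 0 * h (suc n) + ((f 0 · (g ∘ suc) ⊕ (f ∘ suc) ⊗ g) ⊗ h) n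
      ≡⟨ cong (λ t → (f ⊗ g) 0 * h (suc n) + t) (⊗-distribʳ-⊕ h (f 0 · (g ∘ suc)) ((f ∘ suc) ⊗ g) n) ⟩
    (f ⊗ g) 0 * h (suc n) + (((f 0 · (g ∘ suc)) ⊗ h) n + (((f ∘ suc) ⊗ g) ⊗ h) n)
      ≡⟨ cong₂ (λ a b → (f ⊗ g) 0 * h (suc n) + (a + b)) (·-⊗ (f 0) (g ∘ suc) h n) (⊗-assoc (f ∘ suc) g h n) ⟩
    (f ⊗ g) 0 * h (suc n) + (f 0 * ((g ∘ suc) ⊗ h) n + ((f ∘ suc) ⊗ (g ⊗ h)) n)
      ≡⟨ solve 5 (λ a b c d e → (a :* b :+ con (+ 0)) :* c :+ (a :* d :+ e) := a :* (b :* c :+ d) :+ e)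
               refl (f 0) (g 0) (h (suc n)) _ _ ⟩
    (f ⊗ (g ⊗ h)) (suc n) ∎
    where
    open ≡-Reasoning
    open +-*-Solver

  ⊗-identityʳ : ∀ f → f ⊗ 𝟙 ≋ f
  ⊗-identityʳ f = ≋-trans (⊗-comm f 𝟙) (⊗-identityˡ f)

  series-isCommutativeRing : IsCommutativeRing _≋_ _⊕_ _⊗_ ⊝_ 𝟘 𝟙
  series-isCommutativeRing = record
    { isRing = record
      { +-isAbelianGroup = record
        { isGroup = record
          { isMonoid = record
            { isSemigroup = record
              { isMagma = record
                { isEquivalence = record { refl = ≋-refl ; sym = ≋-sym ; trans = ≋-trans }
                ; ∙-cong = λ f≋f′ g≋g′ n → cong₂ _+_ (f≋f′ n) (g≋g′ n) }
              ; assoc = λ f g h n → ℤP.+-assoc (f n) (g n) (h n) }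
            ; identity = (λ f n → ℤP.+-identityˡ (f n)) , (λ f n → ℤP.+-identityʳ (f n)) }
          ; inverse = (λ f n → ℤP.+-inverseˡ (f n)) , (λ f n → ℤP.+-inverseʳ (f n))
          ; ⁻¹-cong = λ f≋g n → cong -_ (f≋g n) }
        ; comm = λ f g n → ℤP.+-comm (f n) (g n) }
      ; *-cong = ⊗-cong
      ; *-assoc = ⊗-assoc
      ; *-identity = ⊗-identityˡ , ⊗-identityʳ
      ; distrib = (λ f g h → ⊗-distribˡ-⊕ f g h) , (λ f g h → ⊗-distribʳ-⊕ f g h) }
    ; *-comm = ⊗-comm }

  seriesRing : CommutativeRing _ _
  seriesRing = record { isCommutativeRing = series-isCommutativeRing }

  open CommutativeRing seriesRing public
    using (semiring) renaming (setoid to ≋-setoid; +-cong to ⊕-cong; -‿cong to ⊝-cong)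
  open import Algebra.Properties.Semiring.Exp semiring public using (_^_; ^-homo-*; ^-congʳ)
  open import Algebra.Properties.Group (CommutativeRing.+-group seriesRing) public using () renaming (∙-cancelˡ to ⊕-cancelˡ)

  κ-⊗ : ∀ a b → κ (a * b) ≋ κ a ⊗ κ b
  κ-⊗ a b n = sym (trans (κ⊗ a (κ b) n) (a·κb n))
    where
    a·κb : a · κ b ≋ κ (a * b)
    a·κb zero    = refl
    a·κb (suc n) = ℤP.*-zeroʳ a

  κ-homomorphism : CommutativeRing.rawRing ℤP.+-*-commutativeRing -Raw-AlmostCommutative⟶ fromCommutativeRing seriesRing
  κ-homomorphism = record
    { ⟦_⟧    = κ
    ; +-homo = λ { a b zero → refl ; a b (suc n) → refl }
    ; *-homo = κ-⊗
    ; -‿homo = λ { a zero → refl ; a (suc n) → refl }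
    ; 0-homo = λ { zero → refl ; (suc n) → refl }
    ; 1-homo = ≋-refl }

  κ-≟ : ∀ a b → Maybe (κ a ≋ κ b)
  κ-≟ a b with a ℤ.≟ b
  ... | yes refl = just ≋-refl
  ... | no _     = nothing

  module SeriesSolver = Algebra.Solver.Ring (CommutativeRing.rawRing ℤP.+-*-commutativeRing)
                          (fromCommutativeRing seriesRing) κ-homomorphism κ-≟

  open SeriesSolver using (solve; _:=_; _:+_; _:*_; :-_; _:-_; con)
  open import Relation.Binary.Reasoning.Setoid ≋-setoid

  1+X 1-X : Series
  1+X = 𝟙 ⊕ X
  1-X = 𝟙 ⊕ ⊝ X

  X⊗-suc : ∀ f n → (X ⊗ f) (suc n) ≡ f n
  X⊗-suc f n = trans (ℤP.+-identityˡ _) (trans (⊗-cong X∘suc≋𝟙 (≋-refl {f}) n) (⊗-identityˡ f n))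
    where
    X∘suc≋𝟙 : X ∘ suc ≋ 𝟙
    X∘suc≋𝟙 zero    = refl
    X∘suc≋𝟙 (suc n) = refl

  κ⊕X⊗-suc : ∀ c f n → (κ c ⊕ X ⊗ f) (suc n) ≡ f n
  κ⊕X⊗-suc c f n = trans (ℤP.+-identityˡ _) (X⊗-suc f n)

  𝟙⊕X⊗-suc : ∀ {f} g → f ≋ 𝟙 ⊕ X ⊗ g → ∀ n → f (suc n) ≡ g n
  𝟙⊕X⊗-suc g f≋𝟙⊕Xg n = trans (f≋𝟙⊕Xg (suc n)) (κ⊕X⊗-suc (+ 1) g n)

  X⊗-injective : ∀ {f g} → X ⊗ f ≋ X ⊗ g → f ≋ g
  X⊗-injective {f} {g} Xf≋Xg n = trans (sym (X⊗-suc f n)) (trans (Xf≋Xg (suc n)) (X⊗-suc g n))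

  -- Coefficient n+1 of a solution only depends on coefficient n of the next one.
  X-recursion-unique : {I : Set} (s : I → I) (a A B : I → Series) →
                       (∀ i → A i ≋ a i ⊕ X ⊗ A (s i)) → (∀ i → B i ≋ a i ⊕ X ⊗ B (s i)) →
                       ∀ i → A i ≋ B i
  X-recursion-unique s a A B A-rec B-rec i zero    = trans (A-rec i 0) (sym (B-rec i 0))
  X-recursion-unique s a A B A-rec B-rec i (suc n) =
    trans (A-rec i (suc n))
          (trans (cong (λ t → a i (suc n) + t)
                       (trans (X⊗-suc (A (s i)) n)
                              (trans (X-recursion-unique s a A B A-rec B-rec (s i) n) (sym (X⊗-suc (B (s i)) n)))))
                 (sym (B-rec i (suc n))))

  ⊗-zeroʳ : ∀ f → f ⊗ 𝟘 ≋ 𝟘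
  ⊗-zeroʳ f n = trans (sumTo-cong (suc n) (λ i _ → ℤP.*-zeroʳ (f i))) (sumTo-zero (suc n))

  ⊕-identityʳ : ∀ f → f ⊕ 𝟘 ≋ f
  ⊕-identityʳ f n = ℤP.+-identityʳ (f n)

  κ-⊕ : ∀ a b → κ (a + b) ≋ κ a ⊕ κ b
  κ-⊕ a b zero    = refl
  κ-⊕ a b (suc n) = refl

  ∑< : ℕ → (ℕ → Series) → Series
  ∑< zero    F = 𝟘
  ∑< (suc k) F = F 0 ⊕ ∑< k (F ∘ suc)

  ∑<-cong : ∀ k {F G : ℕ → Series} → (∀ i → i ℕ.< k → F i ≋ G i) → ∑< k F ≋ ∑< k G
  ∑<-cong zero    F≋G = ≋-refl
  ∑<-cong (suc k) F≋G = ⊕-cong (F≋G 0 ℕ.z<s) (∑<-cong k (λ i i<k → F≋G (suc i) (ℕ.s<s i<k)))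

  ∑<-coefficient : ∀ k F n → ∑< k F n ≡ sumTo k (λ i → F i n)
  ∑<-coefficient zero    F n = refl
  ∑<-coefficient (suc k) F n = cong (λ t → F 0 n + t) (∑<-coefficient k (F ∘ suc) n)

  ∑<-⊗ˡ : ∀ k c F → ∑< k (λ i → c ⊗ F i) ≋ c ⊗ ∑< k F
  ∑<-⊗ˡ zero    c F = ≋-sym (⊗-zeroʳ c)
  ∑<-⊗ˡ (suc k) c F = ≋-trans (⊕-cong (≋-refl {c ⊗ F 0}) (∑<-⊗ˡ k c (F ∘ suc)))
                              (≋-sym (⊗-distribˡ-⊕ c (F 0) (∑< k (F ∘ suc))))

  ∑<-const : ∀ k f → ∑< k (λ _ → f) ≋ κ (+ k) ⊗ f
  ∑<-const zero    f = ≋-sym (κ⊗ (+ 0) f)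
  ∑<-const (suc k) f = begin
    f ⊕ ∑< k (λ _ → f)          ≈⟨ ⊕-cong (≋-refl {f}) (∑<-const k f) ⟩
    f ⊕ κ (+ k) ⊗ f             ≈⟨ solve 2 (λ f c → f :+ c :* f := (con (+ 1) :+ c) :* f) ≋-refl f (κ (+ k)) ⟩
    (κ (+ 1) ⊕ κ (+ k)) ⊗ f     ≈⟨ ⊗-cong (≋-sym (κ-⊕ (+ 1) (+ k))) (≋-refl {f}) ⟩
    κ (+ suc k) ⊗ f             ∎

  ∑<-⊕ : ∀ k F G → ∑< k (λ i → F i ⊕ G i) ≋ ∑< k F ⊕ ∑< k G
  ∑<-⊕ zero    F G = ≋-refl
  ∑<-⊕ (suc k) F G = ≋-trans (⊕-cong (≋-refl {F 0 ⊕ G 0}) (∑<-⊕ k (F ∘ suc) (G ∘ suc)))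
                             (solve 4 (λ a b c d → (a :+ b) :+ (c :+ d) := (a :+ c) :+ (b :+ d))
                                      ≋-refl (F 0) (G 0) (∑< k (F ∘ suc)) (∑< k (G ∘ suc)))

  ∑<-split : ∀ a b F → ∑< (a ℕ.+ b) F ≋ ∑< a F ⊕ ∑< b (λ i → F (a ℕ.+ i))
  ∑<-split zero    b F n = sym (ℤP.+-identityˡ _)
  ∑<-split (suc a) b F n = trans (cong (λ t → F 0 n + t) (∑<-split a b (F ∘ suc) n)) (sym (ℤP.+-assoc (F 0 n) _ _))

  ∑<-vanishing : ∀ k {F} → (∀ i → i ℕ.< k → F i ≋ 𝟘) → ∑< k F ≋ 𝟘
  ∑<-vanishing k F≋𝟘 = ≋-trans (∑<-cong k F≋𝟘) (≋-trans (∑<-const k 𝟘) (⊗-zeroʳ (κ (+ k))))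

  if-cong : ∀ {b b′ : Bool} {f g} → b ≡ b′ → (if b then f else g) ≋ (if b′ then f else g)
  if-cong refl = ≋-refl

  ∑<-below : ∀ {c k} F → c ℕ.≤ k → ∑< k (λ x → if x <ᵇ c then F x else 𝟘) ≋ ∑< c F
  ∑<-below {c} {k} F c≤k = begin
    ∑< k G
      ≡⟨ cong (λ k → ∑< k G) (ℕP.m+[n∸m]≡n c≤k) ⟨
    ∑< (c ℕ.+ (k ∸ c)) G
      ≈⟨ ∑<-split c (k ∸ c) G ⟩
    ∑< c G ⊕ ∑< (k ∸ c) (λ i → G (c ℕ.+ i))
      ≈⟨ ⊕-cong (∑<-cong c (λ x x<c → if-cong (<ᵇ-true x<c)))
                (∑<-vanishing (k ∸ c) (λ i _ → if-cong (<ᵇ-false (ℕP.m≤m+n c i)))) ⟩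
    ∑< c F ⊕ 𝟘
      ≈⟨ ⊕-identityʳ (∑< c F) ⟩
    ∑< c F ∎
    where
    G : ℕ → Series
    G x = if x <ᵇ c then F x else 𝟘

  ∑<-single : ∀ {c k} f → c ℕ.< k → ∑< k (λ x → if x ≡ᵇ c then f else 𝟘) ≋ f
  ∑<-single {c} {k} f c<k = begin
    ∑< k G
      ≡⟨ cong (λ k → ∑< k G) (ℕP.m+[n∸m]≡n (ℕP.<⇒≤ c<k)) ⟨
    ∑< (c ℕ.+ (k ∸ c)) G
      ≈⟨ ∑<-split c (k ∸ c) G ⟩
    ∑< c G ⊕ ∑< (k ∸ c) (λ i → G (c ℕ.+ i))
      ≡⟨ cong (λ j → ∑< c G ⊕ ∑< j (λ i → G (c ℕ.+ i))) (ℕP.+-∸-assoc 1 c<k) ⟩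
    ∑< c G ⊕ (G (c ℕ.+ 0) ⊕ ∑< (k ∸ suc c) (λ i → G (c ℕ.+ suc i)))
      ≈⟨ ⊕-cong (∑<-vanishing c (λ x x<c → if-cong (≡ᵇ-false (ℕP.<⇒≢ x<c))))
                (⊕-cong (if-cong (trans (cong (_≡ᵇ c) (ℕP.+-identityʳ c)) (≡ᵇ-refl c)))
                        (∑<-vanishing (k ∸ suc c) (λ i _ → if-cong (≡ᵇ-false (c+1+i≢c i))))) ⟩
    𝟘 ⊕ (f ⊕ 𝟘)
      ≈⟨ (λ n → trans (ℤP.+-identityˡ _) (ℤP.+-identityʳ (f n))) ⟩
    f ∎
    where
    G : ℕ → Series
    G x = if x ≡ᵇ c then f else 𝟘
    c+1+i≢c : ∀ i → ¬ c ℕ.+ suc i ≡ c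
    c+1+i≢c i c+1+i≡c = ℕP.m≢1+m+n c (trans (sym c+1+i≡c) (ℕP.+-suc c i))

  ∑<-κ⊗ : ∀ k (x : ℕ → ℤ) f → ∑< k (λ i → κ (x i) ⊗ f) ≋ κ (sumTo k x) ⊗ f
  ∑<-κ⊗ zero    x f = ≋-sym (κ⊗ (+ 0) f)
  ∑<-κ⊗ (suc k) x f = begin
    κ (x 0) ⊗ f ⊕ ∑< k (λ i → κ (x (suc i)) ⊗ f)   ≈⟨ ⊕-cong (≋-refl {κ (x 0) ⊗ f}) (∑<-κ⊗ k (x ∘ suc) f) ⟩
    κ (x 0) ⊗ f ⊕ κ (sumTo k (x ∘ suc)) ⊗ f        ≈⟨ ≋-sym (⊗-distribʳ-⊕ f (κ (x 0)) (κ (sumTo k (x ∘ suc)))) ⟩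
    (κ (x 0) ⊕ κ (sumTo k (x ∘ suc))) ⊗ f          ≈⟨ ⊗-cong (≋-sym (κ-⊕ (x 0) (sumTo k (x ∘ suc)))) (≋-refl {f}) ⟩
    κ (sumTo (suc k) x) ⊗ f                        ∎

  geometric-sum : ∀ t k → (t ⊕ ⊝ 𝟙) ⊗ ∑< k (t ^_) ≋ t ^ k ⊕ ⊝ 𝟙
  geometric-sum t zero    = begin
    (t ⊕ ⊝ 𝟙) ⊗ 𝟘   ≈⟨ ⊗-zeroʳ (t ⊕ ⊝ 𝟙) ⟩
    𝟘               ≈⟨ (λ n → sym (ℤP.+-inverseʳ (𝟙 n))) ⟩
    𝟙 ⊕ ⊝ 𝟙         ∎
  geometric-sum t (suc k) = begin
    (t ⊕ ⊝ 𝟙) ⊗ (𝟙 ⊕ ∑< k (λ i → t ⊗ t ^ i))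
      ≈⟨ ⊗-cong (≋-refl {t ⊕ ⊝ 𝟙}) (⊕-cong (≋-refl {𝟙}) (∑<-⊗ˡ k t (t ^_))) ⟩
    (t ⊕ ⊝ 𝟙) ⊗ (𝟙 ⊕ t ⊗ ∑< k (t ^_))
      ≈⟨ solve 2 (λ t s → (t :- con (+ 1)) :* (con (+ 1) :+ t :* s) := (t :- con (+ 1)) :+ t :* ((t :- con (+ 1)) :* s))
               ≋-refl t (∑< k (t ^_)) ⟩
    (t ⊕ ⊝ 𝟙) ⊕ t ⊗ ((t ⊕ ⊝ 𝟙) ⊗ ∑< k (t ^_))
      ≈⟨ ⊕-cong (≋-refl {t ⊕ ⊝ 𝟙}) (⊗-cong (≋-refl {t}) (geometric-sum t k)) ⟩
    (t ⊕ ⊝ 𝟙) ⊕ t ⊗ (t ^ k ⊕ ⊝ 𝟙)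
      ≈⟨ solve 2 (λ t p → (t :- con (+ 1)) :+ t :* (p :- con (+ 1)) := t :* p :- con (+ 1)) ≋-refl t (t ^ k) ⟩
    t ⊗ t ^ k ⊕ ⊝ 𝟙 ∎

  ∑Xᵐ : (ℕ → Series) → Series
  ∑Xᵐ h n = sumTo (suc n) (λ m → h m (n ∸ m))

  ∑Xᵐ-shift : ∀ h → ∑Xᵐ h ≋ h 0 ⊕ X ⊗ ∑Xᵐ (h ∘ suc)
  ∑Xᵐ-shift h zero    = refl
  ∑Xᵐ-shift h (suc n) = cong (λ t → h 0 (suc n) + t) (sym (X⊗-suc (∑Xᵐ (h ∘ suc)) n))

  ∑Xᵐ-cong : ∀ {h k} → (∀ m → h m ≋ k m) → ∑Xᵐ h ≋ ∑Xᵐ k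
  ∑Xᵐ-cong h≋k n = sumTo-cong (suc n) (λ m _ → h≋k m (n ∸ m))

  ∑Xᵐ-⊕ : ∀ h k → ∑Xᵐ (λ m → h m ⊕ k m) ≋ ∑Xᵐ h ⊕ ∑Xᵐ k
  ∑Xᵐ-⊕ h k n = sumTo-+ (suc n) (λ m → h m (n ∸ m)) (λ m → k m (n ∸ m))

  ∑Xᵐ-⊝ : ∀ h → ∑Xᵐ (λ m → ⊝ h m) ≋ ⊝ ∑Xᵐ h
  ∑Xᵐ-⊝ h n = sumTo-neg (suc n) (λ m → h m (n ∸ m))

  ∑Xᵐ-⊗ˡ : ∀ c h → ∑Xᵐ (λ m → c ⊗ h m) ≋ c ⊗ ∑Xᵐ h
  ∑Xᵐ-⊗ˡ c = X-recursion-unique (_∘ suc) (λ h → c ⊗ h 0) (λ h → ∑Xᵐ (λ m → c ⊗ h m)) (λ h → c ⊗ ∑Xᵐ h)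
    (λ h → ∑Xᵐ-shift (λ m → c ⊗ h m))
    (λ h → begin
      c ⊗ ∑Xᵐ h                            ≈⟨ ⊗-cong (≋-refl {c}) (∑Xᵐ-shift h) ⟩
      c ⊗ (h 0 ⊕ X ⊗ ∑Xᵐ (h ∘ suc))         ≈⟨ solve 4 (λ c a x s → c :* (a :+ x :* s) := c :* a :+ x :* (c :* s))
                                                     ≋-refl c (h 0) X (∑Xᵐ (h ∘ suc)) ⟩
      c ⊗ h 0 ⊕ X ⊗ (c ⊗ ∑Xᵐ (h ∘ suc))     ∎)

  infixl 7 _⋆_
  _⋆_ : (ℕ → Series) → (ℕ → Series) → ℕ → Series
  (h ⋆ k) m = ∑< (suc m) (λ i → h i ⊗ k (m ∸ i))

  ∑Xᵐ-⋆ : ∀ h k → ∑Xᵐ h ⊗ ∑Xᵐ k ≋ ∑Xᵐ (h ⋆ k)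
  ∑Xᵐ-⋆ h k = X-recursion-unique {I = (ℕ → Series) × (ℕ → Series)} (λ (h , k) → h ∘ suc , k)
    (λ (h , k) → h 0 ⊗ ∑Xᵐ k) (λ (h , k) → ∑Xᵐ h ⊗ ∑Xᵐ k) (λ (h , k) → ∑Xᵐ (h ⋆ k))
    product-rec convolution-rec (h , k)
    where
    product-rec : ∀ ((h , k) : (ℕ → Series) × (ℕ → Series)) →
                  ∑Xᵐ h ⊗ ∑Xᵐ k ≋ h 0 ⊗ ∑Xᵐ k ⊕ X ⊗ (∑Xᵐ (h ∘ suc) ⊗ ∑Xᵐ k)
    product-rec (h , k) = begin
      ∑Xᵐ h ⊗ ∑Xᵐ k                          ≈⟨ ⊗-cong (∑Xᵐ-shift h) (≋-refl {∑Xᵐ k}) ⟩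
      (h 0 ⊕ X ⊗ ∑Xᵐ (h ∘ suc)) ⊗ ∑Xᵐ k      ≈⟨ solve 4 (λ a x s t → (a :+ x :* s) :* t := a :* t :+ x :* (s :* t))
                                                       ≋-refl (h 0) X (∑Xᵐ (h ∘ suc)) (∑Xᵐ k) ⟩
      h 0 ⊗ ∑Xᵐ k ⊕ X ⊗ (∑Xᵐ (h ∘ suc) ⊗ ∑Xᵐ k) ∎
    -- (h ⋆ k) (suc m) is definitionally  h 0 ⊗ k (suc m) ⊕ ((h ∘ suc) ⋆ k) m.
    convolution-rec : ∀ ((h , k) : (ℕ → Series) × (ℕ → Series)) →
                      ∑Xᵐ (h ⋆ k) ≋ h 0 ⊗ ∑Xᵐ k ⊕ X ⊗ ∑Xᵐ ((h ∘ suc) ⋆ k)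
    convolution-rec (h , k) = begin
      ∑Xᵐ (h ⋆ k)
        ≈⟨ ∑Xᵐ-shift (h ⋆ k) ⟩
      (h 0 ⊗ k 0 ⊕ 𝟘) ⊕ X ⊗ ∑Xᵐ (λ m → h 0 ⊗ k (suc m) ⊕ ((h ∘ suc) ⋆ k) m)
        ≈⟨ ⊕-cong (⊕-identityʳ (h 0 ⊗ k 0))
                  (⊗-cong (≋-refl {X}) (≋-trans (∑Xᵐ-⊕ (λ m → h 0 ⊗ k (suc m)) ((h ∘ suc) ⋆ k))
                                                (⊕-cong (∑Xᵐ-⊗ˡ (h 0) (k ∘ suc)) (≋-refl {∑Xᵐ ((h ∘ suc) ⋆ k)})))) ⟩
      h 0 ⊗ k 0 ⊕ X ⊗ (h 0 ⊗ ∑Xᵐ (k ∘ suc) ⊕ ∑Xᵐ ((h ∘ suc) ⋆ k))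
        ≈⟨ solve 5 (λ a b x s t → a :* b :+ x :* (a :* s :+ t) := a :* (b :+ x :* s) :+ x :* t)
                 ≋-refl (h 0) (k 0) X (∑Xᵐ (k ∘ suc)) (∑Xᵐ ((h ∘ suc) ⋆ k)) ⟩
      h 0 ⊗ (k 0 ⊕ X ⊗ ∑Xᵐ (k ∘ suc)) ⊕ X ⊗ ∑Xᵐ ((h ∘ suc) ⋆ k)
        ≈⟨ ⊕-cong (⊗-cong (≋-refl {h 0}) (≋-sym (∑Xᵐ-shift k))) (≋-refl {X ⊗ ∑Xᵐ ((h ∘ suc) ⋆ k)}) ⟩
      h 0 ⊗ ∑Xᵐ k ⊕ X ⊗ ∑Xᵐ ((h ∘ suc) ⋆ k) ∎

  infix 8 _∘X·_
  _∘X·_ : (ℕ → ℤ) → Series → Series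
  c ∘X· w = ∑Xᵐ (λ m → κ (c m) ⊗ w ^ m)

  ∘X·-shift : ∀ c w → c ∘X· w ≋ κ (c 0) ⊕ X ⊗ (w ⊗ ((c ∘ suc) ∘X· w))
  ∘X·-shift c w = begin
    c ∘X· w
      ≈⟨ ∑Xᵐ-shift (λ m → κ (c m) ⊗ w ^ m) ⟩
    κ (c 0) ⊗ 𝟙 ⊕ X ⊗ ∑Xᵐ (λ m → κ (c (suc m)) ⊗ (w ⊗ w ^ m))
      ≈⟨ ⊕-cong (⊗-identityʳ (κ (c 0)))
                (⊗-cong (≋-refl {X}) (∑Xᵐ-cong (λ m → solve 3 (λ a w p → a :* (w :* p) := w :* (a :* p))
                                                              ≋-refl (κ (c (suc m))) w (w ^ m)))) ⟩
    κ (c 0) ⊕ X ⊗ ∑Xᵐ (λ m → w ⊗ (κ (c (suc m)) ⊗ w ^ m))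
      ≈⟨ ⊕-cong (≋-refl {κ (c 0)}) (⊗-cong (≋-refl {X}) (∑Xᵐ-⊗ˡ w (λ m → κ (c (suc m)) ⊗ w ^ m))) ⟩
    κ (c 0) ⊕ X ⊗ (w ⊗ ((c ∘ suc) ∘X· w)) ∎

  ∘X·-cong : ∀ w {c d : ℕ → ℤ} → (∀ m → c m ≡ d m) → c ∘X· w ≋ d ∘X· w
  ∘X·-cong w c≡d = ∑Xᵐ-cong (λ m → ⊗-cong (λ n → cong (λ t → κ t n) (c≡d m)) (≋-refl {w ^ m}))

  ∘X·-⊗ : ∀ c d w → (c ∘X· w) ⊗ (d ∘X· w) ≋ (c ⊗ d) ∘X· w
  ∘X·-⊗ c d w = ≋-trans (∑Xᵐ-⋆ (λ m → κ (c m) ⊗ w ^ m) (λ m → κ (d m) ⊗ w ^ m)) (∑Xᵐ-cong coefficient)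
    where
    coefficient : ∀ m → ((λ m → κ (c m) ⊗ w ^ m) ⋆ (λ m → κ (d m) ⊗ w ^ m)) m ≋ κ ((c ⊗ d) m) ⊗ w ^ m
    coefficient m = ≋-trans (∑<-cong (suc m) (λ i i≤m → begin
        (κ (c i) ⊗ w ^ i) ⊗ (κ (d (m ∸ i)) ⊗ w ^ (m ∸ i))
          ≈⟨ solve 4 (λ a p b q → (a :* p) :* (b :* q) := (a :* b) :* (p :* q))
                   ≋-refl (κ (c i)) (w ^ i) (κ (d (m ∸ i))) (w ^ (m ∸ i)) ⟩
        (κ (c i) ⊗ κ (d (m ∸ i))) ⊗ (w ^ i ⊗ w ^ (m ∸ i))
          ≈⟨ ⊗-cong (≋-sym (κ-⊗ (c i) (d (m ∸ i))))
                    (≋-trans (≋-sym (^-homo-* w i (m ∸ i))) (^-congʳ w (ℕP.m+[n∸m]≡n (ℕP.≤-pred i≤m)))) ⟩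
        κ (c i * d (m ∸ i)) ⊗ w ^ m ∎))
      (∑<-κ⊗ (suc m) (λ i → c i * d (m ∸ i)) (w ^ m))

  1/[1-X] : Series
  1/[1-X] _ = + 1

  1/[1-X]-rec : 1/[1-X] ≋ 𝟙 ⊕ X ⊗ 1/[1-X]
  1/[1-X]-rec zero    = refl
  1/[1-X]-rec (suc n) = sym (trans (ℤP.+-identityˡ _) (X⊗-suc 1/[1-X] n))

  1/[1-X]-inverse : 1/[1-X] ⊗ 1-X ≋ 𝟙
  1/[1-X]-inverse = begin
    1/[1-X] ⊗ (𝟙 ⊕ ⊝ X)
      ≈⟨ solve 2 (λ g x → g :* (con (+ 1) :- x) := g :- x :* g) ≋-refl 1/[1-X] X ⟩
    1/[1-X] ⊕ ⊝ (X ⊗ 1/[1-X])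
      ≈⟨ ⊕-cong 1/[1-X]-rec (≋-refl {⊝ (X ⊗ 1/[1-X])}) ⟩
    (𝟙 ⊕ X ⊗ 1/[1-X]) ⊕ ⊝ (X ⊗ 1/[1-X])
      ≈⟨ solve 2 (λ x g → (con (+ 1) :+ x :* g) :- x :* g := con (+ 1)) ≋-refl X 1/[1-X] ⟩
    𝟙                                             ∎

  ∘X·-injective : ∀ {w w⁻¹} → w⁻¹ ⊗ w ≋ 𝟙 → ∀ c d → c ∘X· w ≋ d ∘X· w → ∀ m → c m ≡ d m
  ∘X·-injective {w} {w⁻¹} w⁻¹w≋𝟙 c d c∘Xw≋d∘Xw zero    =
    trans (sym (trans (∘X·-shift c w 0) (ℤP.+-identityʳ (c 0))))
          (trans (c∘Xw≋d∘Xw 0) (trans (∘X·-shift d w 0) (ℤP.+-identityʳ (d 0))))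
  ∘X·-injective {w} {w⁻¹} w⁻¹w≋𝟙 c d c∘Xw≋d∘Xw (suc m) =
    ∘X·-injective {w} {w⁻¹} w⁻¹w≋𝟙 (c ∘ suc) (d ∘ suc) tails m
    where
    c₀≡d₀ : c 0 ≡ d 0
    c₀≡d₀ = ∘X·-injective {w} {w⁻¹} w⁻¹w≋𝟙 c d c∘Xw≋d∘Xw 0
    X[w⊗tail] : X ⊗ (w ⊗ ((c ∘ suc) ∘X· w)) ≋ X ⊗ (w ⊗ ((d ∘ suc) ∘X· w))
    X[w⊗tail] = ⊕-cancelˡ (κ (c 0)) _ _ (begin
      κ (c 0) ⊕ X ⊗ (w ⊗ ((c ∘ suc) ∘X· w))   ≈⟨ ∘X·-shift c w ⟨
      c ∘X· w                                 ≈⟨ c∘Xw≋d∘Xw ⟩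
      d ∘X· w                                 ≈⟨ ∘X·-shift d w ⟩
      κ (d 0) ⊕ X ⊗ (w ⊗ ((d ∘ suc) ∘X· w))   ≡⟨ cong (λ a → κ a ⊕ X ⊗ (w ⊗ ((d ∘ suc) ∘X· w))) c₀≡d₀ ⟨
      κ (c 0) ⊕ X ⊗ (w ⊗ ((d ∘ suc) ∘X· w))   ∎)
    tails : (c ∘ suc) ∘X· w ≋ (d ∘ suc) ∘X· w
    tails = begin
      (c ∘ suc) ∘X· w                 ≈⟨ ≋-sym (⊗-identityˡ _) ⟩
      𝟙 ⊗ ((c ∘ suc) ∘X· w)           ≈⟨ ⊗-cong (≋-sym w⁻¹w≋𝟙) ≋-refl ⟩
      (w⁻¹ ⊗ w) ⊗ ((c ∘ suc) ∘X· w)   ≈⟨ ⊗-assoc w⁻¹ w _ ⟩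
      w⁻¹ ⊗ (w ⊗ ((c ∘ suc) ∘X· w))   ≈⟨ ⊗-cong (≋-refl {w⁻¹}) (X⊗-injective X[w⊗tail]) ⟩
      w⁻¹ ⊗ (w ⊗ ((d ∘ suc) ∘X· w))   ≈⟨ ⊗-assoc w⁻¹ w _ ⟨
      (w⁻¹ ⊗ w) ⊗ ((d ∘ suc) ∘X· w)   ≈⟨ ⊗-cong w⁻¹w≋𝟙 ≋-refl ⟩
      𝟙 ⊗ ((d ∘ suc) ∘X· w)           ≈⟨ ⊗-identityˡ _ ⟩
      (d ∘ suc) ∘X· w                 ∎

  private variable A B : Set

  ∑∈ : List A → (A → Series) → Series
  ∑∈ []       F = 𝟘
  ∑∈ (x ∷ xs) F = F x ⊕ ∑∈ xs F

  ∑∈-cong : ∀ {P : A → Set} {xs} (F G : A → Series) → All P xs → (∀ {x} → P x → F x ≋ G x) → ∑∈ xs F ≋ ∑∈ xs G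
  ∑∈-cong F G []         F≋G = ≋-refl
  ∑∈-cong F G (px ∷ pxs) F≋G = ⊕-cong (F≋G px) (∑∈-cong F G pxs F≋G)

  ∑∈-++ : ∀ xs ys (F : A → Series) → ∑∈ (xs ++ ys) F ≋ ∑∈ xs F ⊕ ∑∈ ys F
  ∑∈-++ []       ys F n = sym (ℤP.+-identityˡ _)
  ∑∈-++ (x ∷ xs) ys F n = trans (cong (λ t → F x n + t) (∑∈-++ xs ys F n)) (sym (ℤP.+-assoc (F x n) _ _))

  ∑∈-concatMap : ∀ (f : A → List B) xs (F : B → Series) →
                 ∑∈ (concatMap f xs) F ≋ ∑∈ xs (λ x → ∑∈ (f x) F)
  ∑∈-concatMap f []       F = ≋-refl
  ∑∈-concatMap f (x ∷ xs) F = ≋-trans (∑∈-++ (f x) (concatMap f xs) F)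
                                      (⊕-cong (≋-refl {∑∈ (f x) F}) (∑∈-concatMap f xs F))

  ∑∈-⊕ : ∀ xs (F G : A → Series) → ∑∈ xs (λ x → F x ⊕ G x) ≋ ∑∈ xs F ⊕ ∑∈ xs G
  ∑∈-⊕ []       F G = λ _ → refl
  ∑∈-⊕ (x ∷ xs) F G = ≋-trans (⊕-cong (≋-refl {F x ⊕ G x}) (∑∈-⊕ xs F G))
                              (solve 4 (λ a b c d → (a :+ b) :+ (c :+ d) := (a :+ c) :+ (b :+ d))
                                       ≋-refl (F x) (G x) (∑∈ xs F) (∑∈ xs G))

  ∑∈-⊝ : ∀ xs (F : A → Series) → ∑∈ xs (λ x → ⊝ F x) ≋ ⊝ ∑∈ xs F
  ∑∈-⊝ []       F = λ _ → refl
  ∑∈-⊝ (x ∷ xs) F n = trans (cong (λ t → - F x n + t) (∑∈-⊝ xs F n)) (sym (ℤP.neg-distrib-+ (F x n) _))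

  ∑∈-⊗ˡ : ∀ xs c (F : A → Series) → ∑∈ xs (λ x → c ⊗ F x) ≋ c ⊗ ∑∈ xs F
  ∑∈-⊗ˡ []       c F = ≋-sym (⊗-zeroʳ c)
  ∑∈-⊗ˡ (x ∷ xs) c F = ≋-trans (⊕-cong (≋-refl {c ⊗ F x}) (∑∈-⊗ˡ xs c F)) (≋-sym (⊗-distribˡ-⊕ c (F x) (∑∈ xs F)))

  ∑∈-const : ∀ xs f → ∑∈ xs (λ (_ : A) → f) ≋ κ (+ length xs) ⊗ f
  ∑∈-const []       f = ≋-sym (κ⊗ (+ 0) f)
  ∑∈-const (x ∷ xs) f = begin
    f ⊕ ∑∈ xs (λ _ → f)                  ≈⟨ ⊕-cong (≋-refl {f}) (∑∈-const xs f) ⟩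
    f ⊕ κ (+ length xs) ⊗ f              ≈⟨ solve 2 (λ f c → f :+ c :* f := (con (+ 1) :+ c) :* f) ≋-refl f (κ (+ length xs)) ⟩
    (κ (+ 1) ⊕ κ (+ length xs)) ⊗ f      ≈⟨ ⊗-cong (≋-sym (κ-⊕ (+ 1) (+ length xs))) (≋-refl {f}) ⟩
    κ (+ length (x ∷ xs)) ⊗ f            ∎

  ∑∈-applyUpTo : ∀ (g : ℕ → A) k (F : A → Series) → ∑∈ (applyUpTo g k) F ≋ ∑< k (F ∘ g)
  ∑∈-applyUpTo g zero    F = ≋-refl
  ∑∈-applyUpTo g (suc k) F = ⊕-cong (≋-refl {F (g 0)}) (∑∈-applyUpTo (g ∘ suc) k F)

module Avoidance where

  open import Data.Nat using (ℕ; zero; suc; _<_; _≟_; _<?_; _<ᵇ_; _≡ᵇ_; z<s; s<s)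
  open import Data.Nat.Properties using (<-cmp; <-irrefl; <-asym)
  open import Data.Bool using (Bool; true; false; _∧_; _∨_; not)
  open import Data.Bool.Properties using (∨-assoc; ∨-identityʳ; ∨-commutativeMonoid; ∨-∧-booleanAlgebra)
  open import Algebra.Bundles using (CommutativeMonoid)
  open import Algebra.Lattice.Properties.BooleanAlgebra ∨-∧-booleanAlgebra using (deMorgan₂)
  open import Data.Bool.ListAction using (any; or)
  open import Data.List using (List; []; _∷_; _++_; [_]; map; filter; length; deduplicate)
  open import Data.List.Properties using (map-∘; map-cong; length-map)
  open import Data.Empty using (⊥-elim)
  open import Function using (_∘_; mk⇔)
  open import Relation.Binary.Core using (_Preserves_⟶_)
  open import Relation.Binary.Definitions using (tri<; tri≈; tri>)
  open import Relation.Binary.PropositionalEquality hiding ([_])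
  open import Relation.Nullary using (does; ¬?)
  open import Relation.Nullary.Decidable using (does-⇔)
  open import Relation.Unary using (Pred; Decidable)
  open import Level using (0ℓ)

  private variable A B : Set

  filter-map : ∀ {P Q : Pred ℕ 0ℓ} (P? : Decidable P) (Q? : Decidable Q) (f : ℕ → ℕ) →
               (∀ x → does (P? (f x)) ≡ does (Q? x)) → ∀ xs → filter P? (map f xs) ≡ map f (filter Q? xs)
  filter-map P? Q? f P∘f≡Q []       = refl
  filter-map P? Q? f P∘f≡Q (x ∷ xs) rewrite P∘f≡Q x with does (Q? x)
  ... | true  = cong (f x ∷_) (filter-map P? Q? f P∘f≡Q xs)
  ... | false = filter-map P? Q? f P∘f≡Q xs

  module _ {f : ℕ → ℕ} (f-mono : f Preserves _<_ ⟶ _<_) where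

    mono-reflects-< : ∀ {m n} → f m < f n → m < n
    mono-reflects-< {m} {n} fm<fn with <-cmp m n
    ... | tri< m<n _ _ = m<n
    ... | tri≈ _ refl _ = ⊥-elim (<-irrefl refl fm<fn)
    ... | tri> _ _ n<m = ⊥-elim (<-asym fm<fn (f-mono n<m))

    mono-injective : ∀ {m n} → f m ≡ f n → m ≡ n
    mono-injective {m} {n} fm≡fn with <-cmp m n
    ... | tri< m<n _ _ = ⊥-elim (<-irrefl fm≡fn (f-mono m<n))
    ... | tri≈ _ m≡n _ = m≡n
    ... | tri> _ _ n<m = ⊥-elim (<-irrefl (sym fm≡fn) (f-mono n<m))

    deduplicate-map : ∀ xs → deduplicate _≟_ (map f xs) ≡ map f (deduplicate _≟_ xs)
    deduplicate-map []       = refl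
    deduplicate-map (x ∷ xs) = cong (f x ∷_) (begin
      filter (¬? ∘ (f x ≟_)) (deduplicate _≟_ (map f xs)) ≡⟨ cong (filter (¬? ∘ (f x ≟_))) (deduplicate-map xs) ⟩
      filter (¬? ∘ (f x ≟_)) (map f (deduplicate _≟_ xs)) ≡⟨ filter-map (¬? ∘ (f x ≟_)) (¬? ∘ (x ≟_)) f same-≟ (deduplicate _≟_ xs) ⟩
      map f (filter (¬? ∘ (x ≟_)) (deduplicate _≟_ xs))  ∎)
      where
      open ≡-Reasoning
      same-≟ : ∀ y → not (does (f x ≟ f y)) ≡ not (does (x ≟ y))
      same-≟ y = cong not (does-⇔ (mk⇔ mono-injective (cong f)) (f x ≟ f y) (x ≟ y))

    reduction-map : ∀ t → reduction (map f t) ≡ reduction t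
    reduction-map t = begin
      map (rank (map f t)) (map f t)                                     ≡⟨ map-∘ t ⟨
      map (λ y → rank (map f t) (f y)) t                                 ≡⟨ map-cong rank-map t ⟩
      map (rank t) t                                                     ∎
      where
      open ≡-Reasoning
      rank : List ℕ → ℕ → ℕ
      rank s x = length (deduplicate _≟_ (filter (_<? x) s))
      rank-map : ∀ y → rank (map f t) (f y) ≡ rank t y
      rank-map y = begin
        length (deduplicate _≟_ (filter (_<? f y) (map f t)))
          ≡⟨ cong (length ∘ deduplicate _≟_) (filter-map (_<? f y) (_<? y) f
                    (λ x → does-⇔ (mk⇔ mono-reflects-< f-mono) (f x <? f y) (x <? y)) t) ⟩
        length (deduplicate _≟_ (map f (filter (_<? y) t)))
          ≡⟨ cong length (deduplicate-map (filter (_<? y) t)) ⟩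
        length (map f (deduplicate _≟_ (filter (_<? y) t)))
          ≡⟨ length-map f (deduplicate _≟_ (filter (_<? y) t)) ⟩
        rank t y                                               ∎

  skip : ℕ → ℕ → ℕ
  skip zero    n       = suc n
  skip (suc k) zero    = zero
  skip (suc k) (suc n) = suc (skip k n)

  skip-mono : ∀ k → skip k Preserves _<_ ⟶ _<_
  skip-mono zero    m<n                       = s<s m<n
  skip-mono (suc k) {zero}  {suc n} _         = z<s
  skip-mono (suc k) {suc m} {suc n} (s<s m<n) = s<s (skip-mono k m<n)

  isForbiddenPattern : List ℕ → Bool
  isForbiddenPattern σ = eqList σ p100 ∨ eqList σ p102 ∨ eqList σ p201

  forbidden : ℕ → ℕ → ℕ → Bool
  forbidden p q r = (q <ᵇ p) ∧ not (r <ᵇ q) ∧ not (r ≡ᵇ p)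

  forbidden-triple : ∀ p q r → isForbiddenPattern (reduction (p ∷ q ∷ r ∷ [])) ≡ forbidden p q r
  forbidden-triple-skip : ∀ k p q r → isForbiddenPattern (reduction (skip k p ∷ skip k q ∷ skip k r ∷ [])) ≡ forbidden p q r

  -- A clause with a variable removes a value k that no entry takes (the entries are
  -- skip k p, skip k q, skip k r), which does not change the reduction; what remains
  -- are the thirteen order types with values in {0, 1, 2}, decided by computation.
  forbidden-triple (suc p) (suc q) (suc r)       = forbidden-triple-skip 0 p q r
  forbidden-triple 0 (suc (suc q)) (suc (suc r)) = forbidden-triple-skip 1 0 (suc q) (suc r)
  forbidden-triple (suc (suc p)) 0 (suc (suc r)) = forbidden-triple-skip 1 (suc p) 0 (suc r)
  forbidden-triple (suc (suc p)) (suc (suc q)) 0 = forbidden-triple-skip 1 (suc p) (suc q) 0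
  forbidden-triple 0 0 (suc (suc r))             = forbidden-triple-skip 1 0 0 (suc r)
  forbidden-triple 0 (suc (suc q)) 0             = forbidden-triple-skip 1 0 (suc q) 0
  forbidden-triple (suc (suc p)) 0 0             = forbidden-triple-skip 1 (suc p) 0 0
  forbidden-triple 0 1 (suc (suc (suc r)))       = forbidden-triple-skip 2 0 1 (suc (suc r))
  forbidden-triple 1 0 (suc (suc (suc r)))       = forbidden-triple-skip 2 1 0 (suc (suc r))
  forbidden-triple 0 (suc (suc (suc q))) 1       = forbidden-triple-skip 2 0 (suc (suc q)) 1
  forbidden-triple 1 (suc (suc (suc q))) 0       = forbidden-triple-skip 2 1 (suc (suc q)) 0
  forbidden-triple (suc (suc (suc p))) 0 1       = forbidden-triple-skip 2 (suc (suc p)) 0 1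
  forbidden-triple (suc (suc (suc p))) 1 0       = forbidden-triple-skip 2 (suc (suc p)) 1 0
  forbidden-triple 0 0 0                         = refl
  forbidden-triple 0 0 1                         = refl
  forbidden-triple 0 1 0                         = refl
  forbidden-triple 1 0 0                         = refl
  forbidden-triple 0 1 1                         = refl
  forbidden-triple 1 0 1                         = refl
  forbidden-triple 1 1 0                         = refl
  forbidden-triple 0 1 2                         = refl
  forbidden-triple 0 2 1                         = refl
  forbidden-triple 1 0 2                         = refl
  forbidden-triple 1 2 0                         = refl
  forbidden-triple 2 0 1                         = refl
  forbidden-triple 2 1 0                         = refl

  forbidden-triple-skip k p q r = trans (cong isForbiddenPattern (reduction-map (skip-mono k) (p ∷ q ∷ r ∷ []))) (forbidden-triple p q r)

  ∨-interchange : ∀ a b c d → (a ∨ b) ∨ (c ∨ d) ≡ (a ∨ c) ∨ (b ∨ d)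
  ∨-interchange = interchange
    where open import Algebra.Properties.CommutativeSemigroup (CommutativeMonoid.commutativeSemigroup ∨-commutativeMonoid)

  any-++ : ∀ (f : A → Bool) xs ys → any f (xs ++ ys) ≡ any f xs ∨ any f ys
  any-++ f []       ys = refl
  any-++ f (x ∷ xs) ys = trans (cong (f x ∨_) (any-++ f xs ys)) (sym (∨-assoc (f x) _ _))

  any-map : ∀ (f : B → Bool) (g : A → B) xs → any f (map g xs) ≡ any (f ∘ g) xs
  any-map f g xs = cong or (sym (map-∘ xs))

  any-∨ : ∀ (f g : A → Bool) xs → any (λ t → f t ∨ g t) xs ≡ any f xs ∨ any g xs
  any-∨ f g []       = refl
  any-∨ f g (x ∷ xs) = trans (cong ((f x ∨ g x) ∨_) (any-∨ f g xs)) (∨-interchange (f x) (g x) (any f xs) (any g xs))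

  anyPair : (ℕ → ℕ → Bool) → List ℕ → Bool
  anyPair g []      = false
  anyPair g (p ∷ a) = any (g p) a ∨ anyPair g a

  anyTriple : (ℕ → ℕ → ℕ → Bool) → List ℕ → Bool
  anyTriple g []      = false
  anyTriple g (p ∷ a) = anyPair (g p) a ∨ anyTriple g a

  any-subseqs-1 : ∀ (f : List ℕ → Bool) a → any f (subseqs 1 a) ≡ any (λ p → f [ p ]) a
  any-subseqs-1 f []      = refl
  any-subseqs-1 f (p ∷ a) = cong (f [ p ] ∨_) (any-subseqs-1 f a)

  any-subseqs-2 : ∀ (f : List ℕ → Bool) a → any f (subseqs 2 a) ≡ anyPair (λ p q → f (p ∷ q ∷ [])) a
  any-subseqs-2 f []      = refl
  any-subseqs-2 f (p ∷ a) = trans (any-++ f (map (p ∷_) (subseqs 1 a)) (subseqs 2 a))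
    (cong₂ _∨_ (trans (any-map f (p ∷_) (subseqs 1 a)) (any-subseqs-1 (f ∘ (p ∷_)) a)) (any-subseqs-2 f a))

  any-subseqs-3 : ∀ (f : List ℕ → Bool) a → any f (subseqs 3 a) ≡ anyTriple (λ p q r → f (p ∷ q ∷ r ∷ [])) a
  any-subseqs-3 f []      = refl
  any-subseqs-3 f (p ∷ a) = trans (any-++ f (map (p ∷_) (subseqs 2 a)) (subseqs 3 a))
    (cong₂ _∨_ (trans (any-map f (p ∷_) (subseqs 2 a)) (any-subseqs-2 (f ∘ (p ∷_)) a)) (any-subseqs-3 f a))

  any-snoc : ∀ (g : ℕ → Bool) a x → any g (a ++ [ x ]) ≡ any g a ∨ g x
  any-snoc g a x = trans (any-++ g a [ x ]) (cong (any g a ∨_) (∨-identityʳ (g x)))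

  anyPair-snoc : ∀ g a x → anyPair g (a ++ [ x ]) ≡ anyPair g a ∨ any (λ p → g p x) a
  anyPair-snoc g []      x = refl
  anyPair-snoc g (p ∷ a) x = trans (cong₂ _∨_ (any-snoc (g p) a x) (anyPair-snoc g a x))
                                   (∨-interchange (any (g p) a) (g p x) (anyPair g a) _)

  anyTriple-snoc : ∀ g a x → anyTriple g (a ++ [ x ]) ≡ anyTriple g a ∨ anyPair (λ p q → g p q x) a
  anyTriple-snoc g []      x = refl
  anyTriple-snoc g (p ∷ a) x = trans (cong₂ _∨_ (anyPair-snoc (g p) a x) (anyTriple-snoc g a x))
                                     (∨-interchange (anyPair (g p) a) _ (anyTriple g a) _)

  any-cong : ∀ {f g : A → Bool} → (∀ x → f x ≡ g x) → ∀ xs → any f xs ≡ any g xs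
  any-cong f≡g []       = refl
  any-cong f≡g (x ∷ xs) = cong₂ _∨_ (f≡g x) (any-cong f≡g xs)

  anyPair-cong : ∀ {g h} → (∀ p q → g p q ≡ h p q) → ∀ a → anyPair g a ≡ anyPair h a
  anyPair-cong g≡h []      = refl
  anyPair-cong g≡h (p ∷ a) = cong₂ _∨_ (any-cong (g≡h p) a) (anyPair-cong g≡h a)

  anyTriple-cong : ∀ {g h} → (∀ p q r → g p q r ≡ h p q r) → ∀ a → anyTriple g a ≡ anyTriple h a
  anyTriple-cong g≡h []      = refl
  anyTriple-cong g≡h (p ∷ a) = cong₂ _∨_ (anyPair-cong (g≡h p) a) (anyTriple-cong g≡h a)

  noForbiddenTriple : List ℕ → Bool
  noForbiddenTriple a = not (anyTriple forbidden a)

  avoidsAll≡noForbiddenTriple : ∀ a → avoidsAll a ≡ noForbiddenTriple a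
  avoidsAll≡noForbiddenTriple a = begin
    not (any e100 S) ∧ not (any e102 S) ∧ not (any e201 S)
      ≡⟨ cong (not (any e100 S) ∧_) (deMorgan₂ (any e102 S) _) ⟨
    not (any e100 S) ∧ not (any e102 S ∨ any e201 S)
      ≡⟨ deMorgan₂ (any e100 S) _ ⟨
    not (any e100 S ∨ any e102 S ∨ any e201 S)
      ≡⟨ cong (λ b → not (any e100 S ∨ b)) (any-∨ e102 e201 S) ⟨
    not (any e100 S ∨ any (λ t → e102 t ∨ e201 t) S)
      ≡⟨ cong not (any-∨ e100 _ S) ⟨
    not (any (isForbiddenPattern ∘ reduction) S)
      ≡⟨ cong not (any-subseqs-3 (isForbiddenPattern ∘ reduction) a) ⟩
    not (anyTriple (λ p q r → isForbiddenPattern (reduction (p ∷ q ∷ r ∷ []))) a)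
      ≡⟨ cong not (anyTriple-cong forbidden-triple a) ⟩
    noForbiddenTriple a ∎
    where
    open ≡-Reasoning
    S : List (List ℕ)
    S = subseqs 3 a
    e100 e102 e201 : List ℕ → Bool
    e100 t = eqList (reduction t) p100
    e102 t = eqList (reduction t) p102
    e201 t = eqList (reduction t) p201

  appendable : List ℕ → ℕ → Bool
  appendable a y = not (anyPair (λ p q → forbidden p q y) a)

  noForbiddenTriple-snoc : ∀ a x → noForbiddenTriple (a ++ [ x ]) ≡ noForbiddenTriple a ∧ appendable a x
  noForbiddenTriple-snoc a x = trans (cong not (anyTriple-snoc forbidden a x))
                                     (deMorgan₂ (anyTriple forbidden a) (anyPair (λ p q → forbidden p q x) a))

  appendable-snoc : ∀ a x y → appendable (a ++ [ x ]) y ≡ appendable a y ∧ not (any (λ p → forbidden p x y) a)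
  appendable-snoc a x y = trans (cong not (anyPair-snoc (λ p q → forbidden p q y) a x))
                                (deMorgan₂ (anyPair (λ p q → forbidden p q y) a) (any (λ p → forbidden p x y) a))

module Automaton where

  open Avoidance
  open Comparisons
  open PowerSeries using (Series; _≋_; sumTo; sumTo-cong; sumTo-zero)
  open import Data.Nat as ℕ using (ℕ; zero; suc; _<_; _≤_; _≟_; _<?_; _<ᵇ_; _≡ᵇ_; z<s; z≤n)
  open import Data.Nat.Properties
    using (<-cmp; <-irrefl; <-trans; ≤-<-trans; ≤-trans; ≤-refl; <⇒≤; <⇒≢; ≮⇒≥; ≡ᵇ⇒≡)
  open import Data.Bool using (Bool; true; false; _∧_; _∨_; not; if_then_else_; T)
  open import Data.Bool.Properties using (∧-identityʳ; ∧-zeroʳ; ∨-zeroʳ)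
  open import Data.Bool.ListAction using (any)
  open import Data.List using (List; []; _∷_; _++_; [_]; map; foldl; concatMap; applyUpTo; upTo; filter; length)
  open import Data.List.Properties using (foldl-∷ʳ; map-++; map-∘; map-cong)
  open import Data.List.Reverse using (Reverse; []; _∶_∶ʳ_; reverseView)
  open import Data.Integer as ℤ using (ℤ; +_)
  import Data.Integer.Properties as ℤP
  import Data.Nat.Properties as ℕP
  open import Data.List.Membership.Propositional using (_∈_)
  open import Data.List.Membership.Propositional.Properties using (∈-++⁺ˡ; ∈-++⁺ʳ)
  open import Data.List.Relation.Unary.All as All using (All; []; _∷_)
  open import Data.List.Relation.Unary.All.Properties using (++⁺)
  open import Data.List.Relation.Unary.Any using (here; there)
  open import Data.Product using (_×_; _,_; proj₁; proj₂; ∃-syntax)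
  open import Data.Empty using (⊥-elim)
  open import Relation.Binary.Definitions using (tri<; tri≈; tri>)
  open import Function using (_∘_)
  open import Relation.Binary.PropositionalEquality hiding ([_])
  open import Relation.Nullary using (¬_; yes; no)

  ∈-snoc : ∀ a {x : ℕ} → x ∈ a ++ [ x ]
  ∈-snoc a = ∈-++⁺ʳ a (here refl)

  All-snoc : ∀ {P : ℕ → Set} {a x} → All P a → P x → All P (a ++ [ x ])
  All-snoc Pa Px = ++⁺ Pa (Px ∷ [])

  forbidden-true : ∀ {p x y} → x < p → x ≤ y → ¬ y ≡ p → forbidden p x y ≡ true
  forbidden-true x<p x≤y y≢p rewrite <ᵇ-true x<p | <ᵇ-false x≤y | ≡ᵇ-false y≢p = refl

  forbidden-false-≤ : ∀ {p x y} → p ≤ x → forbidden p x y ≡ false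
  forbidden-false-≤ p≤x rewrite <ᵇ-false p≤x = refl

  forbidden-false-< : ∀ {p x y} → y < x → forbidden p x y ≡ false
  forbidden-false-< {p} {x} y<x rewrite <ᵇ-true y<x = ∧-zeroʳ (x <ᵇ p)

  forbidden-false-≡ : ∀ {p x} → forbidden p x p ≡ false
  forbidden-false-≡ {p} {x} rewrite ≡ᵇ-refl p = trans (cong ((x <ᵇ p) ∧_) (∧-zeroʳ _)) (∧-zeroʳ _)

  any-true : ∀ (f : ℕ → Bool) {p a} → p ∈ a → f p ≡ true → any f a ≡ true
  any-true f         (here refl) fp≡true rewrite fp≡true = refl
  any-true f {a = q ∷ a} (there p∈a) fp≡true rewrite any-true f p∈a fp≡true = ∨-zeroʳ (f q)

  any-false : ∀ (f : ℕ → Bool) {a} → All (λ p → f p ≡ false) a → any f a ≡ false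
  any-false f []              = refl
  any-false f (fp≡false ∷ fa) rewrite fp≡false = any-false f fa

  -- What an avoiding sequence remembers for its continuations:
  -- ascending L σ : weakly increasing, with maximum L and largest smaller entry σ (0 if none);
  -- dipped b c    : it dropped from its maximum c to b ≥ σ; the next entry must be < b or = c;
  -- descending c  : its last entry is c and from now on it must strictly decrease.
  data State : Set where
    ascending  : ℕ → ℕ → State
    dipped     : ℕ → ℕ → State
    descending : ℕ → State

  allowed : State → ℕ → Bool
  allowed (ascending L σ) y = true
  allowed (dipped b c)    y = (y <ᵇ b) ∨ (y ≡ᵇ c)
  allowed (descending c)  y = y <ᵇ c

  step : State → ℕ → State
  step (ascending L σ) x = if x <ᵇ σ then descending x
                           else if x <ᵇ L then dipped x L
                           else if x ≡ᵇ L then ascending L σ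
                           else ascending x L
  step (dipped b c)    x = if x <ᵇ b then descending x else dipped b c
  step (descending c)  x = descending x

  step-ascending-< : ∀ {L σ x} → x < σ → step (ascending L σ) x ≡ descending x
  step-ascending-< x<σ rewrite <ᵇ-true x<σ = refl

  step-ascending-dip : ∀ {L σ x} → σ ≤ x → x < L → step (ascending L σ) x ≡ dipped x L
  step-ascending-dip σ≤x x<L rewrite <ᵇ-false σ≤x | <ᵇ-true x<L = refl

  step-ascending-≡ : ∀ {L σ} → σ ≤ L → step (ascending L σ) L ≡ ascending L σ
  step-ascending-≡ {L} σ≤L rewrite <ᵇ-false σ≤L | <ᵇ-false (≤-refl {L}) | ≡ᵇ-refl L = refl

  step-ascending-> : ∀ {L σ x} → σ ≤ L → L < x → step (ascending L σ) x ≡ ascending x L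
  step-ascending-> σ≤L L<x
    rewrite <ᵇ-false (≤-trans σ≤L (<⇒≤ L<x)) | <ᵇ-false (<⇒≤ L<x) | ≡ᵇ-false (≢-sym (<⇒≢ L<x)) = refl

  step-dipped-< : ∀ {b c x} → x < b → step (dipped b c) x ≡ descending x
  step-dipped-< x<b rewrite <ᵇ-true x<b = refl

  step-dipped-≥ : ∀ {b c x} → b ≤ x → step (dipped b c) x ≡ dipped b c
  step-dipped-≥ b≤x rewrite <ᵇ-false b≤x = refl

  Shape : List ℕ → State → Set
  Shape a (ascending L σ) = All (_≤ L) a × All (λ p → p < L → p ≤ σ) a × (0 < L → L ∈ a) × (0 < σ → σ ∈ a × σ < L)
  Shape a (dipped b c)    = b ∈ a × c ∈ a × b < c × All (_≤ c) a
  Shape a (descending c)  = c ∈ a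

  Invariant : List ℕ → State → Set
  Invariant a s = (∀ y → appendable a y ≡ allowed s y) × Shape a s

  appendable-snoc-max : ∀ {a x s} → (∀ y → appendable a y ≡ allowed s y) → All (_≤ x) a →
                        ∀ y → appendable (a ++ [ x ]) y ≡ allowed s y
  appendable-snoc-max {a} {x} {s} inv a≤x y = begin
    appendable (a ++ [ x ]) y                           ≡⟨ appendable-snoc a x y ⟩
    appendable a y ∧ not (any (λ p → forbidden p x y) a) ≡⟨ cong₂ (λ u v → u ∧ not v) (inv y)
                                                               (any-false (λ p → forbidden p x y) (All.map forbidden-false-≤ a≤x)) ⟩
    allowed s y ∧ true                                  ≡⟨ ∧-identityʳ _ ⟩
    allowed s y                                         ∎
    where open ≡-Reasoning

  appendable-snoc-descending : ∀ {a x s} → (∀ y → appendable a y ≡ allowed s y) →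
    (∀ y → y < x → allowed s y ≡ true) →
    (∀ y → x ≤ y → allowed s y ≡ true → ∃[ p ] p ∈ a × x < p × ¬ y ≡ p) →
    ∀ y → appendable (a ++ [ x ]) y ≡ allowed (descending x) y
  appendable-snoc-descending {a} {x} {s} inv below above y
    with trans (appendable-snoc a x y) (cong (_∧ not (any (λ p → forbidden p x y) a)) (inv y)) | y <? x
  ... | snoc≡ | yes y<x = trans snoc≡ (trans (cong₂ (λ u v → u ∧ not v) (below y y<x)
                                                    (any-false (λ p → forbidden p x y) {a} (All.tabulate (λ {p} _ → forbidden-false-< {p} y<x))))
                                             (sym (<ᵇ-true y<x)))
  ... | snoc≡ | no y≮x = trans snoc≡ (trans (killed (allowed s y) refl) (sym (<ᵇ-false (≮⇒≥ y≮x))))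
    where
    killed : ∀ b → allowed s y ≡ b → b ∧ not (any (λ p → forbidden p x y) a) ≡ false
    killed false _         = refl
    killed true  allowed-y with above y (≮⇒≥ y≮x) allowed-y
    ... | p , p∈a , x<p , y≢p = cong not (any-true (λ p → forbidden p x y) p∈a (forbidden-true x<p (≮⇒≥ y≮x) y≢p))

  invariant-descending : ∀ {a c x} → Invariant a (descending c) → allowed (descending c) x ≡ true →
                         Invariant (a ++ [ x ]) (step (descending c) x)
  invariant-descending {a} {c} {x} (inv , c∈a) x<ᵇc = appendable-snoc-descending {s = descending c} inv below above , ∈-snoc a
    where
    x<c : x < c
    x<c = <ᵇ-sound x<ᵇc
    below : ∀ y → y < x → allowed (descending c) y ≡ true
    below y y<x = <ᵇ-true (<-trans y<x x<c)
    above : ∀ y → x ≤ y → allowed (descending c) y ≡ true → ∃[ p ] p ∈ a × x < p × ¬ y ≡ p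
    above y _ y<ᵇc = c , c∈a , x<c , <⇒≢ (<ᵇ-sound y<ᵇc)

  allowed-dipped-≥ : ∀ {b c y} → allowed (dipped b c) y ≡ true → b ≤ y → y ≡ c
  allowed-dipped-≥ {b} {c} {y} allowed-y b≤y rewrite <ᵇ-false b≤y = ≡ᵇ⇒≡ y c (subst T (sym allowed-y) _)

  invariant-dipped : ∀ {a b c x} → Invariant a (dipped b c) → allowed (dipped b c) x ≡ true →
                     Invariant (a ++ [ x ]) (step (dipped b c) x)
  invariant-dipped {a} {b} {c} {x} (inv , b∈a , c∈a , b<c , a≤c) allowed-x with x <? b
  ... | yes x<b rewrite step-dipped-< {b} {c} x<b = appendable-snoc-descending {s = dipped b c} inv below above , ∈-snoc a
    where
    below : ∀ y → y < x → allowed (dipped b c) y ≡ true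
    below y y<x rewrite <ᵇ-true (<-trans y<x x<b) = refl
    above : ∀ y → x ≤ y → allowed (dipped b c) y ≡ true → ∃[ p ] p ∈ a × x < p × ¬ y ≡ p
    above y _ allowed-y with y <? b
    ... | yes y<b = b , b∈a , x<b , <⇒≢ y<b
    ... | no y≮b  = b , b∈a , x<b , λ y≡b → <⇒≢ b<c (trans (sym y≡b) (allowed-dipped-≥ allowed-y (≮⇒≥ y≮b)))
  ... | no x≮b rewrite step-dipped-≥ {b} {c} (≮⇒≥ x≮b) | allowed-dipped-≥ {b} {c} allowed-x (≮⇒≥ x≮b) =
    appendable-snoc-max {s = dipped b c} inv a≤c , ∈-++⁺ˡ b∈a , ∈-++⁺ˡ c∈a , b<c , All-snoc a≤c ≤-refl

  shape-σ≤L : ∀ {a L σ} → Shape a (ascending L σ) → σ ≤ L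
  shape-σ≤L {σ = zero}  _                     = z≤n
  shape-σ≤L {σ = suc σ} (_ , _ , _ , σ-facts) = <⇒≤ (proj₂ (σ-facts z<s))

  appendable-snoc-dipped : ∀ {a L σ x} → Invariant a (ascending L σ) → σ ≤ x → x < L →
                           ∀ y → appendable (a ++ [ x ]) y ≡ allowed (dipped x L) y
  appendable-snoc-dipped {a} {L} {σ} {x} (inv , a≤L , below-σ , L-fact , _) σ≤x x<L y
    with trans (appendable-snoc a x y) (cong (_∧ not (any (λ p → forbidden p x y) a)) (inv y)) | y <? x | y ≟ L
  ... | snoc≡ | yes y<x | _ =
    trans snoc≡ (trans (cong not (any-false (λ p → forbidden p x y) {a} (All.tabulate (λ {p} _ → forbidden-false-< {p} y<x))))
                       (sym (cong (_∨ (y ≡ᵇ L)) (<ᵇ-true y<x))))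
  ... | snoc≡ | no y≮x | yes refl =
    trans snoc≡ (trans (cong not (any-false (λ p → forbidden p x L) (All.zipWith none (a≤L , below-σ))))
                       (sym (cong₂ _∨_ (<ᵇ-false (<⇒≤ x<L)) (≡ᵇ-refl L))))
    where
    none : ∀ {p} → p ≤ L × (p < L → p ≤ σ) → forbidden p x L ≡ false
    none {p} (p≤L , p<L⇒p≤σ) with <-cmp p L
    ... | tri< p<L _ _ = forbidden-false-≤ (≤-trans (p<L⇒p≤σ p<L) σ≤x)
    ... | tri≈ _ refl _ = forbidden-false-≡ {p} {x}
    ... | tri> _ _ L<p = ⊥-elim (<-irrefl refl (≤-<-trans p≤L L<p))
  ... | snoc≡ | no y≮x | no y≢L =
    trans snoc≡ (trans (cong not (any-true (λ p → forbidden p x y) (L-fact (≤-<-trans z≤n x<L))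
                                           (forbidden-true x<L (≮⇒≥ y≮x) y≢L)))
                       (sym (cong₂ _∨_ (<ᵇ-false (≮⇒≥ y≮x)) (≡ᵇ-false y≢L))))

  invariant-ascending : ∀ {a L σ x} → Invariant a (ascending L σ) → Invariant (a ++ [ x ]) (step (ascending L σ) x)
  invariant-ascending {a} {L} {σ} {x} I@(inv , a≤L , below-σ , L-fact , σ-facts) with <-cmp x L
  ... | tri> _ _ L<x rewrite step-ascending-> (shape-σ≤L (proj₂ I)) L<x =
    appendable-snoc-max {s = ascending L σ} inv a≤x , All-snoc a≤x ≤-refl ,
    All-snoc (All.map (λ p≤L _ → p≤L) a≤L) (λ x<x → ⊥-elim (<-irrefl refl x<x)) ,
    (λ _ → ∈-snoc a) , (λ 0<L → ∈-++⁺ˡ (L-fact 0<L) , L<x)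
    where a≤x = All.map (λ p≤L → ≤-trans p≤L (<⇒≤ L<x)) a≤L
  ... | tri≈ _ refl _ rewrite step-ascending-≡ (shape-σ≤L (proj₂ I)) =
    appendable-snoc-max {s = ascending L σ} inv a≤L , All-snoc a≤L ≤-refl ,
    All-snoc below-σ (λ L<L → ⊥-elim (<-irrefl refl L<L)) ,
    (λ _ → ∈-snoc a) , (λ 0<σ → ∈-++⁺ˡ (proj₁ (σ-facts 0<σ)) , proj₂ (σ-facts 0<σ))
  ... | tri< x<L _ _ with x <? σ
  ...   | yes x<σ rewrite step-ascending-< {L} x<σ = appendable-snoc-descending {s = ascending L σ} inv (λ _ _ → refl) above , ∈-snoc a
    where
    σ∈a : σ ∈ a
    σ∈a = proj₁ (σ-facts (≤-<-trans z≤n x<σ))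
    σ<L : σ < L
    σ<L = proj₂ (σ-facts (≤-<-trans z≤n x<σ))
    above : ∀ y → x ≤ y → allowed (ascending L σ) y ≡ true → ∃[ p ] p ∈ a × x < p × ¬ y ≡ p
    above y _ _ with y ≟ L
    ... | yes refl = σ , σ∈a , x<σ , (λ L≡σ → <-irrefl (sym L≡σ) σ<L)
    ... | no y≢L   = L , L-fact (≤-<-trans z≤n x<L) , x<L , y≢L
  ...   | no x≮σ rewrite step-ascending-dip (≮⇒≥ x≮σ) x<L =
    appendable-snoc-dipped I (≮⇒≥ x≮σ) x<L , ∈-snoc a , ∈-++⁺ˡ (L-fact (≤-<-trans z≤n x<L)) , x<L ,
    All-snoc a≤L (<⇒≤ x<L)

  step-invariant : ∀ {a s x} → Invariant a s → allowed s x ≡ true → Invariant (a ++ [ x ]) (step s x)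
  step-invariant {s = ascending L σ} I _         = invariant-ascending I
  step-invariant {s = dipped b c}    I allowed-x = invariant-dipped I allowed-x
  step-invariant {s = descending c}  I allowed-x = invariant-descending I allowed-x

  initial : State
  initial = ascending 0 0

  ∧-true : ∀ {u v} → u ∧ v ≡ true → u ≡ true × v ≡ true
  ∧-true {true} {true} _ = refl , refl

  stateOf : List ℕ → State
  stateOf = foldl step initial

  invariant-stateOf : ∀ a → noForbiddenTriple a ≡ true → Invariant a (stateOf a)
  invariant-stateOf a = go (reverseView a)
    where
    go : ∀ {a} → Reverse a → noForbiddenTriple a ≡ true → Invariant a (stateOf a)
    go []              _     = (λ _ → refl) , [] , [] , (λ ()) , (λ ())
    go (a ∶ ra ∶ʳ x) valid with ∧-true (trans (sym (noForbiddenTriple-snoc a x)) valid)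
    ... | valid-a , appendable-x =
      subst (Invariant (a ++ [ x ])) (sym (foldl-∷ʳ step initial x a))
            (step-invariant inv-a (trans (sym (proj₁ inv-a x)) appendable-x))
      where
      inv-a : Invariant a (stateOf a)
      inv-a = go ra valid-a

  -- Coefficient r counts the ways to append r more entries to a sequence of length m in state s.
  completions : State → ℕ → Series
  completions s m zero    = + 1
  completions s m (suc r) = sumTo (suc m) (λ x → if allowed s x then completions (step s x) (suc m) r else + 0)

  avoidsAll-snoc : ∀ a x → avoidsAll (a ++ [ x ]) ≡ avoidsAll a ∧ appendable a x
  avoidsAll-snoc a x = begin
    avoidsAll (a ++ [ x ])                ≡⟨ avoidsAll≡noForbiddenTriple (a ++ [ x ]) ⟩
    noForbiddenTriple (a ++ [ x ])        ≡⟨ noForbiddenTriple-snoc a x ⟩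
    noForbiddenTriple a ∧ appendable a x  ≡⟨ cong (_∧ appendable a x) (avoidsAll≡noForbiddenTriple a) ⟨
    avoidsAll a ∧ appendable a x          ∎
    where open ≡-Reasoning

  weight : ℕ → ℕ → List ℕ → ℤ
  weight n r a = if avoidsAll a then completions (stateOf a) n r else + 0

  weight-extensions : ∀ n r a → sumTo (suc n) (λ x → weight (suc n) r (a ++ [ x ])) ≡ weight n (suc r) a
  weight-extensions n r a with avoidsAll a in avoids-a
  ... | false = trans (sumTo-cong (suc n) (λ x _ → cong (λ b → if b then completions (stateOf (a ++ [ x ])) (suc n) r else + 0)
                                                         (trans (avoidsAll-snoc a x) (cong (_∧ appendable a x) avoids-a))))
                      (sumTo-zero (suc n))
  ... | true  = sumTo-cong (suc n) (λ x _ → cong₂ (λ b s → if b then completions s (suc n) r else + 0)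
                                                  (trans (avoidsAll-snoc a x) (trans (cong (_∧ appendable a x) avoids-a) (proj₁ inv-a x)))
                                                  (foldl-∷ʳ step initial x a))
    where
    inv-a : Invariant a (stateOf a)
    inv-a = invariant-stateOf a (trans (sym (avoidsAll≡noForbiddenTriple a)) avoids-a)

  sumℤ-applyUpTo : ∀ (f : ℕ → ℤ) g k → sumℤ (map f (applyUpTo g k)) ≡ sumTo k (f ∘ g)
  sumℤ-applyUpTo f g zero    = refl
  sumℤ-applyUpTo f g (suc k) = cong (λ t → f (g 0) ℤ.+ t) (sumℤ-applyUpTo f (g ∘ suc) k)

  sumℤ-concatMap : ∀ {A B : Set} (f : B → ℤ) (h : A → List B) xs →
                   sumℤ (map f (concatMap h xs)) ≡ sumℤ (map (λ x → sumℤ (map f (h x))) xs)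
  sumℤ-concatMap f h []       = refl
  sumℤ-concatMap f h (x ∷ xs) = begin
    sumℤ (map f (h x ++ concatMap h xs))                        ≡⟨ cong sumℤ (map-++ f (h x) _) ⟩
    sumℤ (map f (h x) ++ map f (concatMap h xs))                ≡⟨ sumℤ-++ (map f (h x)) _ ⟩
    sumℤ (map f (h x)) ℤ.+ sumℤ (map f (concatMap h xs))        ≡⟨ cong (λ t → sumℤ (map f (h x)) ℤ.+ t) (sumℤ-concatMap f h xs) ⟩
    sumℤ (map (λ x → sumℤ (map f (h x))) (x ∷ xs))              ∎
    where
    open ≡-Reasoning
    sumℤ-++ : ∀ us vs → sumℤ (us ++ vs) ≡ sumℤ us ℤ.+ sumℤ vs
    sumℤ-++ []       vs = sym (ℤP.+-identityˡ _)
    sumℤ-++ (u ∷ us) vs = trans (cong (λ t → u ℤ.+ t) (sumℤ-++ us vs)) (sym (ℤP.+-assoc u _ _))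

  weighted-count : ∀ n r → sumℤ (map (weight n r) (invSeqs n)) ≡ completions initial 0 (n ℕ.+ r)
  weighted-count zero    r = ℤP.+-identityʳ _
  weighted-count (suc n) r = begin
    sumℤ (map (weight (suc n) r) (concatMap (λ a → map (λ x → a ++ [ x ]) (upTo (suc n))) (invSeqs n)))
      ≡⟨ sumℤ-concatMap (weight (suc n) r) (λ a → map (λ x → a ++ [ x ]) (upTo (suc n))) (invSeqs n) ⟩
    sumℤ (map (λ a → sumℤ (map (weight (suc n) r) (map (λ x → a ++ [ x ]) (upTo (suc n))))) (invSeqs n))
      ≡⟨ cong sumℤ (map-cong extensions (invSeqs n)) ⟩
    sumℤ (map (weight n (suc r)) (invSeqs n))
      ≡⟨ weighted-count n (suc r) ⟩
    completions initial 0 (n ℕ.+ suc r)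
      ≡⟨ cong (completions initial 0) (ℕP.+-suc n r) ⟩
    completions initial 0 (suc n ℕ.+ r) ∎
    where
    open ≡-Reasoning
    extensions : ∀ a → sumℤ (map (weight (suc n) r) (map (λ x → a ++ [ x ]) (upTo (suc n)))) ≡ weight n (suc r) a
    extensions a = begin
      sumℤ (map (weight (suc n) r) (map (λ x → a ++ [ x ]) (upTo (suc n))))
        ≡⟨ cong sumℤ (map-∘ {g = weight (suc n) r} {f = λ x → a ++ [ x ]} (upTo (suc n))) ⟨
      sumℤ (map (λ x → weight (suc n) r (a ++ [ x ])) (upTo (suc n)))
        ≡⟨ sumℤ-applyUpTo (λ x → weight (suc n) r (a ++ [ x ])) (λ x → x) (suc n) ⟩
      sumTo (suc n) (λ x → weight (suc n) r (a ++ [ x ]))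
        ≡⟨ weight-extensions n r a ⟩
      weight n (suc r) a                                                     ∎

  count-as-completions : F ≋ completions initial 0
  count-as-completions n = begin
    + I n                                     ≡⟨ length-filter (invSeqs n) ⟩
    sumℤ (map (weight n 0) (invSeqs n))       ≡⟨ weighted-count n 0 ⟩
    completions initial 0 (n ℕ.+ 0)           ≡⟨ cong (completions initial 0) (ℕP.+-identityʳ n) ⟩
    completions initial 0 n                   ∎
    where
    open ≡-Reasoning
    length-filter : ∀ as → + length (filter (λ a → avoidsAll a Data.Bool.≟ true) as) ≡ sumℤ (map (weight n 0) as)
    length-filter []       = refl
    length-filter (a ∷ as) with avoidsAll a
    ... | true  = cong (λ t → + 1 ℤ.+ t) (length-filter as)
    ... | false = trans (length-filter as) (sym (ℤP.+-identityˡ _))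

module CompletionSeries where

  open Comparisons
  open PowerSeries
  open Automaton
  open import Data.Nat as ℕ using (ℕ; zero; suc; _∸_; _<_; _≤_; _<ᵇ_; _≡ᵇ_; z≤n; s≤s)
  import Data.Nat.Properties as ℕP
  open import Data.Integer as ℤ using (ℤ; +_)
  import Data.Integer.Properties as ℤP
  open import Data.Bool using (true; false; if_then_else_)
  open import Data.Product using (_×_; _,_)
  open import Data.List using (List; []; _∷_; applyUpTo; concatMap)
  open import Data.List.Relation.Unary.All as All using (All; []; _∷_)
  open import Data.List.Relation.Unary.All.Properties using (concat⁺; map⁺; applyUpTo⁺₁)
  open import Relation.Nullary using (yes; no)
  open import Relation.Binary.PropositionalEquality
  open SeriesSolver using (solve; _:=_; _:+_; _:*_; :-_; _:-_; con)

  1+X-power : ∀ c → 1+X ^ c ≋ 𝟙 ⊕ X ⊗ ∑< c (1+X ^_)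
  1+X-power c = begin
    1+X ^ c
      ≈⟨ solve 1 (λ p → p := con (+ 1) :+ (p :- con (+ 1))) ≋-refl (1+X ^ c) ⟩
    𝟙 ⊕ (1+X ^ c ⊕ ⊝ 𝟙)
      ≈⟨ ⊕-cong (≋-refl {𝟙}) (≋-sym (geometric-sum 1+X c)) ⟩
    𝟙 ⊕ (1+X ⊕ ⊝ 𝟙) ⊗ ∑< c (1+X ^_)
      ≈⟨ ⊕-cong (≋-refl {𝟙}) (⊗-cong (solve 1 (λ x → (con (+ 1) :+ x) :- con (+ 1) := x) ≋-refl X)
                                                                                  (≋-refl {∑< c (1+X ^_)})) ⟩
    𝟙 ⊕ X ⊗ ∑< c (1+X ^_)                          ∎
    where open import Relation.Binary.Reasoning.Setoid ≋-setoid

  continuations : State → ℕ → ℕ → Series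
  continuations s m x = if allowed s x then completions (step s x) (suc m) else 𝟘

  completions-suc : ∀ s m r → completions s m (suc r) ≡ ∑< (suc m) (continuations s m) r
  completions-suc s m r = begin
    completions s m (suc r)                            ≡⟨ sumTo-cong (suc m) (λ x _ → coefficient-if {x} (allowed s x)) ⟨
    sumTo (suc m) (λ x → continuations s m x r)        ≡⟨ ∑<-coefficient (suc m) (continuations s m) r ⟨
    ∑< (suc m) (continuations s m) r                   ∎
    where
    open ≡-Reasoning
    coefficient-if : ∀ {x} b → (if b then completions (step s x) (suc m) else 𝟘) r
                               ≡ (if b then completions (step s x) (suc m) r else + 0)
    coefficient-if true  = refl
    coefficient-if false = refl

  completions-unfold : ∀ s m → completions s m ≋ 𝟙 ⊕ X ⊗ ∑< (suc m) (continuations s m)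
  completions-unfold s m zero    = refl
  completions-unfold s m (suc r) = trans (completions-suc s m r) (sym (κ⊕X⊗-suc (+ 1) (∑< (suc m) (continuations s m)) r))

  completions-descending : ∀ {c m} → c ≤ suc m → completions (descending c) m ≋ 1+X ^ c
  completions-descending {c}     c≤1+m zero    = sym (1+X-power c 0)
  completions-descending {c} {m} c≤1+m (suc r) = begin
    completions (descending c) m (suc r)
      ≡⟨ completions-suc (descending c) m r ⟩
    ∑< (suc m) (λ x → if x <ᵇ c then completions (descending x) (suc m) else 𝟘) r
      ≡⟨ ∑<-below (λ x → completions (descending x) (suc m)) c≤1+m r ⟩
    ∑< c (λ x → completions (descending x) (suc m)) r
      ≡⟨ ∑<-coefficient c (λ x → completions (descending x) (suc m)) r ⟩
    sumTo c (λ x → completions (descending x) (suc m) r)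
      ≡⟨ sumTo-cong c (λ x x<c → completions-descending (ℕP.≤-trans (ℕP.<⇒≤ x<c) (ℕP.m≤n⇒m≤1+n c≤1+m)) r) ⟩
    sumTo c (λ x → (1+X ^ x) r)
      ≡⟨ ∑<-coefficient c (1+X ^_) r ⟨
    ∑< c (1+X ^_) r
      ≡⟨ 𝟙⊕X⊗-suc (∑< c (1+X ^_)) (1+X-power c) r ⟨
    (1+X ^ c) (suc r) ∎
    where open ≡-Reasoning

  1+X^b/[1-X]-rec : ∀ b → 1+X ^ b ⊗ 1/[1-X] ≋ 𝟙 ⊕ X ⊗ (∑< b (1+X ^_) ⊕ 1+X ^ b ⊗ 1/[1-X])
  1+X^b/[1-X]-rec b = begin
    1+X ^ b ⊗ 1/[1-X]
      ≈⟨ ⊗-cong (≋-refl {1+X ^ b}) 1/[1-X]-rec ⟩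
    1+X ^ b ⊗ (𝟙 ⊕ X ⊗ 1/[1-X])
      ≈⟨ solve 3 (λ p x g → p :* (con (+ 1) :+ x :* g) := p :+ x :* (p :* g)) ≋-refl (1+X ^ b) X 1/[1-X] ⟩
    1+X ^ b ⊕ X ⊗ (1+X ^ b ⊗ 1/[1-X])
      ≈⟨ ⊕-cong (1+X-power b) (≋-refl {X ⊗ (1+X ^ b ⊗ 1/[1-X])}) ⟩
    (𝟙 ⊕ X ⊗ ∑< b (1+X ^_)) ⊕ X ⊗ (1+X ^ b ⊗ 1/[1-X])
      ≈⟨ solve 3 (λ x s w → (con (+ 1) :+ x :* s) :+ x :* w := con (+ 1) :+ x :* (s :+ w))
               ≋-refl X (∑< b (1+X ^_)) (1+X ^ b ⊗ 1/[1-X]) ⟩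
    𝟙 ⊕ X ⊗ (∑< b (1+X ^_) ⊕ 1+X ^ b ⊗ 1/[1-X]) ∎
    where open import Relation.Binary.Reasoning.Setoid ≋-setoid

  completions-dipped : ∀ {b c m} → b < c → c ≤ m → completions (dipped b c) m ≋ 1+X ^ b ⊗ 1/[1-X]
  completions-dipped {b}         b<c c≤m zero    = sym (1+X^b/[1-X]-rec b 0)
  completions-dipped {b} {c} {m} b<c c≤m (suc r) = begin
    completions (dipped b c) m (suc r)
      ≡⟨ completions-suc (dipped b c) m r ⟩
    ∑< (suc m) (continuations (dipped b c) m) r
      ≡⟨ ∑<-cong (suc m) {G = λ x → below x ⊕ repeat x} (λ x _ → split x) r ⟩
    ∑< (suc m) (λ x → below x ⊕ repeat x) r
      ≡⟨ ∑<-⊕ (suc m) below repeat r ⟩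
    ∑< (suc m) below r ℤ.+ ∑< (suc m) repeat r
      ≡⟨ cong₂ ℤ._+_ (∑<-below D (ℕP.≤-trans (ℕP.<⇒≤ b<c) (ℕP.m≤n⇒m≤1+n c≤m)) r) (∑<-single W (s≤s c≤m) r) ⟩
    ∑< b D r ℤ.+ W r
      ≡⟨ cong₂ ℤ._+_ (∑<-cong b (λ x x<b → completions-descending (x≤2+m x<b)) r) (completions-dipped b<c (ℕP.m≤n⇒m≤1+n c≤m) r) ⟩
    ∑< b (1+X ^_) r ℤ.+ (1+X ^ b ⊗ 1/[1-X]) r
      ≡⟨ 𝟙⊕X⊗-suc (∑< b (1+X ^_) ⊕ 1+X ^ b ⊗ 1/[1-X]) (1+X^b/[1-X]-rec b) r ⟨
    (1+X ^ b ⊗ 1/[1-X]) (suc r) ∎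
    where
    open ≡-Reasoning
    W : Series
    W = completions (dipped b c) (suc m)
    D below repeat : ℕ → Series
    D      x = completions (descending x) (suc m)
    below  x = if x <ᵇ b then D x else 𝟘
    repeat x = if x ≡ᵇ c then W else 𝟘
    x≤2+m : ∀ {x} → x < b → x ≤ suc (suc m)
    x≤2+m x<b = ℕP.≤-trans (ℕP.<⇒≤ (ℕP.<-trans x<b b<c)) (ℕP.≤-trans c≤m (ℕP.m≤n+m m 2))
    split : ∀ x → continuations (dipped b c) m x ≋ below x ⊕ repeat x
    split x with x ℕ.<? b
    ... | yes x<b rewrite <ᵇ-true x<b | ≡ᵇ-false (ℕP.<⇒≢ (ℕP.<-trans x<b b<c)) = ≋-sym (⊕-identityʳ (D x))
    ... | no x≮b  rewrite <ᵇ-false (ℕP.≮⇒≥ x≮b) = λ n → sym (ℤP.+-identityˡ _)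

  children : ℕ → ℕ × ℕ → List (ℕ × ℕ)
  children m (L , σ) = (L , σ) ∷ applyUpTo (λ i → (suc L ℕ.+ i , L)) (m ∸ L)

  ascendingCompletions : ℕ → ℕ × ℕ → Series
  ascendingCompletions m (L , σ) = completions (ascending L σ) m

  exits : ℕ → ℕ → Series
  exits L σ = ∑< σ (1+X ^_) ⊕ ∑< (L ∸ σ) (λ i → 1+X ^ (σ ℕ.+ i) ⊗ 1/[1-X])

  -- The next entry x either starts a descent (x < σ), a dip (σ ≤ x < L), repeats L, or raises the maximum.
  completions-ascending : ∀ {L σ m} → σ ≤ L → L ≤ m →
    completions (ascending L σ) m ≋ 𝟙 ⊕ X ⊗ (exits L σ ⊕ ∑∈ (children m (L , σ)) (ascendingCompletions (suc m)))
  completions-ascending {L} {σ} {m} σ≤L L≤m = ≋-trans (completions-unfold (ascending L σ) m)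
                                                      (⊕-cong (≋-refl {𝟙}) (⊗-cong (≋-refl {X}) next-entry))
    where
    open import Relation.Binary.Reasoning.Setoid ≋-setoid
    G : ℕ → Series
    G x = completions (step (ascending L σ) x) (suc m)
    next-entry : ∑< (suc m) G ≋ exits L σ ⊕ ∑∈ (children m (L , σ)) (ascendingCompletions (suc m))
    next-entry = begin
      ∑< (suc m) G
        ≡⟨ cong (λ k → ∑< k G) (trans (ℕP.+-suc L (m ∸ L)) (cong suc (ℕP.m+[n∸m]≡n L≤m))) ⟨
      ∑< (L ℕ.+ suc (m ∸ L)) G
        ≈⟨ ∑<-split L (suc (m ∸ L)) G ⟩
      ∑< L G ⊕ (G (L ℕ.+ 0) ⊕ ∑< (m ∸ L) (λ i → G (L ℕ.+ suc i)))
        ≡⟨ cong (λ k → ∑< k G ⊕ (G (L ℕ.+ 0) ⊕ ∑< (m ∸ L) (λ i → G (L ℕ.+ suc i)))) (ℕP.m+[n∸m]≡n σ≤L) ⟨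
      ∑< (σ ℕ.+ (L ∸ σ)) G ⊕ (G (L ℕ.+ 0) ⊕ ∑< (m ∸ L) (λ i → G (L ℕ.+ suc i)))
        ≈⟨ ⊕-cong (∑<-split σ (L ∸ σ) G) (≋-refl {G (L ℕ.+ 0) ⊕ ∑< (m ∸ L) (λ i → G (L ℕ.+ suc i))}) ⟩
      (∑< σ G ⊕ ∑< (L ∸ σ) (λ i → G (σ ℕ.+ i))) ⊕ (G (L ℕ.+ 0) ⊕ ∑< (m ∸ L) (λ i → G (L ℕ.+ suc i)))
        ≈⟨ ⊕-cong (⊕-cong (∑<-cong σ descents) (∑<-cong (L ∸ σ) dips)) (⊕-cong repeat (≋-sym raises)) ⟩
      exits L σ ⊕ ∑∈ (children m (L , σ)) (ascendingCompletions (suc m)) ∎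
      where
      descents : ∀ x → x < σ → G x ≋ 1+X ^ x
      descents x x<σ rewrite step-ascending-< {L} x<σ =
        completions-descending (ℕP.≤-trans (ℕP.<⇒≤ x<σ) (ℕP.≤-trans σ≤L (ℕP.≤-trans L≤m (ℕP.m≤n+m m 2))))
      dips : ∀ i → i < L ∸ σ → G (σ ℕ.+ i) ≋ 1+X ^ (σ ℕ.+ i) ⊗ 1/[1-X]
      dips i i<L∸σ = dip (subst (σ ℕ.+ i <_) (ℕP.m+[n∸m]≡n σ≤L) (ℕP.+-monoʳ-< σ i<L∸σ))
        where
        dip : σ ℕ.+ i < L → G (σ ℕ.+ i) ≋ 1+X ^ (σ ℕ.+ i) ⊗ 1/[1-X]
        dip σ+i<L rewrite step-ascending-dip (ℕP.m≤m+n σ i) σ+i<L = completions-dipped σ+i<L (ℕP.m≤n⇒m≤1+n L≤m)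
      repeat : G (L ℕ.+ 0) ≋ ascendingCompletions (suc m) (L , σ)
      repeat rewrite ℕP.+-identityʳ L | step-ascending-≡ σ≤L = ≋-refl
      raises : ∑∈ (applyUpTo (λ i → (suc L ℕ.+ i , L)) (m ∸ L)) (ascendingCompletions (suc m)) ≋ ∑< (m ∸ L) (λ i → G (L ℕ.+ suc i))
      raises = ≋-trans (∑∈-applyUpTo (λ i → (suc L ℕ.+ i , L)) (m ∸ L) (ascendingCompletions (suc m)))
                       (∑<-cong (m ∸ L) (λ i _ → raise i))
        where
        raise : ∀ i → ascendingCompletions (suc m) (suc L ℕ.+ i , L) ≋ G (L ℕ.+ suc i)
        raise i rewrite ℕP.+-suc L i | step-ascending-> {L} {σ} {suc (L ℕ.+ i)} σ≤L (s≤s (ℕP.m≤m+n L i)) = ≋-refl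

  -- The pairs (L , σ) of the ascending states at length m, with multiplicity.
  labels : ℕ → List (ℕ × ℕ)
  labels zero    = (0 , 0) ∷ []
  labels (suc m) = concatMap (children m) (labels m)

  Label : ℕ → ℕ × ℕ → Set
  Label m (L , σ) = σ ≤ L × L ≤ m

  labels-valid : ∀ m → All (Label m) (labels m)
  labels-valid zero    = (z≤n , z≤n) ∷ []
  labels-valid (suc m) = concat⁺ (map⁺ (All.map children-valid (labels-valid m)))
    where
    children-valid : ∀ {p} → Label m p → All (Label (suc m)) (children m p)
    children-valid {L , σ} (σ≤L , L≤m) = (σ≤L , ℕP.m≤n⇒m≤1+n L≤m) ∷ applyUpTo⁺₁ _ (m ∸ L) (λ {i} i<m∸L →
      ℕP.m≤n⇒m≤1+n (ℕP.m≤m+n L i) , s≤s (subst (L ℕ.+ i ≤_) (ℕP.m+[n∸m]≡n L≤m) (ℕP.+-monoʳ-≤ L (ℕP.<⇒≤ i<m∸L))))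

  ascendingTotal exitTotal : ℕ → Series
  ascendingTotal m = ∑∈ (labels m) (ascendingCompletions m)
  exitTotal      m = ∑∈ (labels m) (λ (L , σ) → 𝟙 ⊕ X ⊗ exits L σ)

  ascendingTotal-rec : ∀ m → ascendingTotal m ≋ exitTotal m ⊕ X ⊗ ascendingTotal (suc m)
  ascendingTotal-rec m = go (labels m) (labels-valid m)
    where
    open import Relation.Binary.Reasoning.Setoid ≋-setoid
    go : ∀ ps → All (Label m) ps →
         ∑∈ ps (ascendingCompletions m)
         ≋ ∑∈ ps (λ (L , σ) → 𝟙 ⊕ X ⊗ exits L σ) ⊕ X ⊗ ∑∈ (concatMap (children m) ps) (ascendingCompletions (suc m))
    go []             []                    = ≋-sym (≋-trans (⊕-cong (≋-refl {𝟘}) (⊗-zeroʳ X)) (⊕-identityʳ 𝟘))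
    go ((L , σ) ∷ ps) ((σ≤L , L≤m) ∷ valid) = begin
      ascendingCompletions m (L , σ) ⊕ ∑∈ ps (ascendingCompletions m)
        ≈⟨ ⊕-cong (completions-ascending σ≤L L≤m) (go ps valid) ⟩
      (𝟙 ⊕ X ⊗ (exits L σ ⊕ C)) ⊕ (E ⊕ X ⊗ Cs)
        ≈⟨ solve 5 (λ x e c h d → (con (+ 1) :+ x :* (e :+ c)) :+ (h :+ x :* d) := ((con (+ 1) :+ x :* e) :+ h) :+ x :* (c :+ d))
                 ≋-refl X (exits L σ) C E Cs ⟩
      ((𝟙 ⊕ X ⊗ exits L σ) ⊕ E) ⊕ X ⊗ (C ⊕ Cs)
        ≈⟨ ⊕-cong (≋-refl {(𝟙 ⊕ X ⊗ exits L σ) ⊕ E})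
                  (⊗-cong (≋-refl {X}) (≋-sym (∑∈-++ (children m (L , σ)) (concatMap (children m) ps) (ascendingCompletions (suc m))))) ⟩
      ((𝟙 ⊕ X ⊗ exits L σ) ⊕ E) ⊕ X ⊗ ∑∈ (concatMap (children m) ((L , σ) ∷ ps)) (ascendingCompletions (suc m)) ∎
      where
      C Cs E : Series
      C  = ∑∈ (children m (L , σ)) (ascendingCompletions (suc m))
      Cs = ∑∈ (concatMap (children m) ps) (ascendingCompletions (suc m))
      E  = ∑∈ ps (λ (L , σ) → 𝟙 ⊕ X ⊗ exits L σ)

  F-as-∑Xᵐ : F ≋ ∑Xᵐ exitTotal
  F-as-∑Xᵐ = ≋-trans (λ n → trans (count-as-completions n) (sym (ℤP.+-identityʳ _)))
                     (X-recursion-unique suc exitTotal ascendingTotal (λ m → ∑Xᵐ (λ k → exitTotal (m ℕ.+ k)))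
                                         ascendingTotal-rec ∑Xᵐ-rec 0)
    where
    ∑Xᵐ-rec : ∀ m → ∑Xᵐ (λ k → exitTotal (m ℕ.+ k)) ≋ exitTotal m ⊕ X ⊗ ∑Xᵐ (λ k → exitTotal (suc m ℕ.+ k))
    ∑Xᵐ-rec m = ≋-trans (∑Xᵐ-shift (λ k → exitTotal (m ℕ.+ k)))
                        (⊕-cong (λ n → cong (λ j → exitTotal j n) (ℕP.+-identityʳ m))
                                (⊗-cong (≋-refl {X}) (∑Xᵐ-cong (λ k n → cong (λ j → exitTotal j n) (ℕP.+-suc m k)))))

  X⊗∑<-1+X-powers : ∀ c → X ⊗ ∑< c (1+X ^_) ≋ 1+X ^ c ⊕ ⊝ 𝟙
  X⊗∑<-1+X-powers c = begin
    X ⊗ ∑< c (1+X ^_)                 ≈⟨ solve 1 (λ a → a := (con (+ 1) :+ a) :- con (+ 1)) ≋-refl (X ⊗ ∑< c (1+X ^_)) ⟩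
    (𝟙 ⊕ X ⊗ ∑< c (1+X ^_)) ⊕ ⊝ 𝟙     ≈⟨ ⊕-cong (≋-sym (1+X-power c)) (≋-refl {⊝ 𝟙}) ⟩
    1+X ^ c ⊕ ⊝ 𝟙                     ∎
    where open import Relation.Binary.Reasoning.Setoid ≋-setoid

  exit-identity : ∀ {L σ} → σ ≤ L → 1-X ⊗ (𝟙 ⊕ X ⊗ exits L σ) ≋ 1+X ^ L ⊕ ⊝ (X ⊗ 1+X ^ σ)
  exit-identity {L} {σ} σ≤L = begin
    1-X ⊗ (𝟙 ⊕ X ⊗ (S ⊕ ∑< k (λ i → 1+X ^ (σ ℕ.+ i) ⊗ 1/[1-X])))
      ≈⟨ ⊗-cong (≋-refl {1-X}) (⊕-cong (≋-refl {𝟙}) (⊗-cong (≋-refl {X}) (⊕-cong (≋-refl {S}) dips))) ⟩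
    1-X ⊗ (𝟙 ⊕ X ⊗ (S ⊕ (a ⊗ 1/[1-X]) ⊗ T))
      ≈⟨ solve 5 (λ x s a g t → (con (+ 1) :- x) :* (con (+ 1) :+ x :* (s :+ (a :* g) :* t))
                                := (con (+ 1) :- x) :+ (con (+ 1) :- x) :* (x :* s) :+ a :* (g :* (con (+ 1) :- x)) :* (x :* t))
               ≋-refl X S a 1/[1-X] T ⟩
    1-X ⊕ 1-X ⊗ (X ⊗ S) ⊕ a ⊗ (1/[1-X] ⊗ 1-X) ⊗ (X ⊗ T)
      ≈⟨ ⊕-cong (⊕-cong (≋-refl {1-X}) (⊗-cong (≋-refl {1-X}) (X⊗∑<-1+X-powers σ)))
                (⊗-cong (⊗-cong (≋-refl {a}) 1/[1-X]-inverse) (X⊗∑<-1+X-powers k)) ⟩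
    1-X ⊕ 1-X ⊗ (a ⊕ ⊝ 𝟙) ⊕ a ⊗ 𝟙 ⊗ (1+X ^ k ⊕ ⊝ 𝟙)
      ≈⟨ solve 3 (λ x a b → (con (+ 1) :- x) :+ (con (+ 1) :- x) :* (a :- con (+ 1)) :+ a :* con (+ 1) :* (b :- con (+ 1))
                            := a :* b :- x :* a) ≋-refl X a (1+X ^ k) ⟩
    a ⊗ 1+X ^ k ⊕ ⊝ (X ⊗ a)
      ≈⟨ ⊕-cong (≋-trans (≋-sym (^-homo-* 1+X σ k)) (^-congʳ 1+X (ℕP.m+[n∸m]≡n σ≤L))) (≋-refl {⊝ (X ⊗ a)}) ⟩
    1+X ^ L ⊕ ⊝ (X ⊗ 1+X ^ σ) ∎
    where
    open import Relation.Binary.Reasoning.Setoid ≋-setoid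
    k : ℕ
    k = L ∸ σ
    S T a : Series
    S = ∑< σ (1+X ^_)
    T = ∑< k (1+X ^_)
    a = 1+X ^ σ
    dips : ∑< k (λ i → 1+X ^ (σ ℕ.+ i) ⊗ 1/[1-X]) ≋ (a ⊗ 1/[1-X]) ⊗ T
    dips = ≋-trans (∑<-cong k (λ i _ → ≋-trans (⊗-cong (^-homo-* 1+X σ i) (≋-refl {1/[1-X]}))
                                               (solve 3 (λ p q g → (p :* q) :* g := (p :* g) :* q) ≋-refl a (1+X ^ i) 1/[1-X])))
                   (∑<-⊗ˡ k (a ⊗ 1/[1-X]) (1+X ^_))

  maxPowers : Series → ℕ → Series
  maxPowers t m = ∑∈ (labels m) (λ (L , _) → t ^ L)

  secondPowers : Series → ℕ → Series
  secondPowers t m = ∑∈ (labels m) (λ (_ , σ) → t ^ σ)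

  P Q : Series
  P = ∑Xᵐ (maxPowers 1+X)
  Q = ∑Xᵐ (secondPowers 1+X)

  exitTotal-equation : ∀ m → 1-X ⊗ exitTotal m ≋ maxPowers 1+X m ⊕ ⊝ (X ⊗ secondPowers 1+X m)
  exitTotal-equation m = begin
    1-X ⊗ exitTotal m
      ≈⟨ ≋-sym (∑∈-⊗ˡ (labels m) 1-X (λ (L , σ) → 𝟙 ⊕ X ⊗ exits L σ)) ⟩
    ∑∈ (labels m) (λ (L , σ) → 1-X ⊗ (𝟙 ⊕ X ⊗ exits L σ))
      ≈⟨ ∑∈-cong _ (λ (L , σ) → 1+X ^ L ⊕ ⊝ (X ⊗ 1+X ^ σ)) (labels-valid m) (λ (σ≤L , _) → exit-identity σ≤L) ⟩
    ∑∈ (labels m) (λ (L , σ) → 1+X ^ L ⊕ ⊝ (X ⊗ 1+X ^ σ))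
      ≈⟨ ∑∈-⊕ (labels m) (λ (L , _) → 1+X ^ L) (λ (_ , σ) → ⊝ (X ⊗ 1+X ^ σ)) ⟩
    maxPowers 1+X m ⊕ ∑∈ (labels m) (λ (_ , σ) → ⊝ (X ⊗ 1+X ^ σ))
      ≈⟨ ⊕-cong (≋-refl {maxPowers 1+X m})
                (≋-trans (∑∈-⊝ (labels m) (λ (_ , σ) → X ⊗ 1+X ^ σ)) (⊝-cong (∑∈-⊗ˡ (labels m) X (λ (_ , σ) → 1+X ^ σ)))) ⟩
    maxPowers 1+X m ⊕ ⊝ (X ⊗ secondPowers 1+X m) ∎
    where open import Relation.Binary.Reasoning.Setoid ≋-setoid

  F-equation : 1-X ⊗ F ≋ P ⊕ ⊝ (X ⊗ Q)
  F-equation = begin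
    1-X ⊗ F
      ≈⟨ ⊗-cong (≋-refl {1-X}) F-as-∑Xᵐ ⟩
    1-X ⊗ ∑Xᵐ exitTotal
      ≈⟨ ≋-sym (∑Xᵐ-⊗ˡ 1-X exitTotal) ⟩
    ∑Xᵐ (λ m → 1-X ⊗ exitTotal m)
      ≈⟨ ∑Xᵐ-cong exitTotal-equation ⟩
    ∑Xᵐ (λ m → maxPowers 1+X m ⊕ ⊝ (X ⊗ secondPowers 1+X m))
      ≈⟨ ∑Xᵐ-⊕ (maxPowers 1+X) (λ m → ⊝ (X ⊗ secondPowers 1+X m)) ⟩
    P ⊕ ∑Xᵐ (λ m → ⊝ (X ⊗ secondPowers 1+X m))
      ≈⟨ ⊕-cong (≋-refl {P}) (≋-trans (∑Xᵐ-⊝ (λ m → X ⊗ secondPowers 1+X m)) (⊝-cong (∑Xᵐ-⊗ˡ X (secondPowers 1+X)))) ⟩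
    P ⊕ ⊝ (X ⊗ Q) ∎
    where open import Relation.Binary.Reasoning.Setoid ≋-setoid

module KernelIdentities where

  open PowerSeries
  open CompletionSeries
  open import Data.Nat as ℕ using (ℕ; zero; suc; _∸_; _≤_)
  import Data.Nat.Properties as ℕP
  open import Data.Integer using (+_)
  open import Data.Product using (_,_)
  open import Data.List using (length)
  open import Relation.Binary.PropositionalEquality using (sym; trans; cong)
  open import Relation.Binary.Reasoning.Setoid ≋-setoid
  open SeriesSolver using (solve; _:=_; _:+_; _:*_; :-_; _:-_; con)

  labelCount : ℕ → ℕ
  labelCount m = length (labels m)

  gapPowers : Series → ℕ → Series
  gapPowers t m = ∑∈ (labels m) (λ (L , _) → κ (+ (m ∸ L)) ⊗ t ^ L)

  ∑∈-children : ∀ m L σ F → ∑∈ (children m (L , σ)) F ≋ F (L , σ) ⊕ ∑< (m ∸ L) (λ i → F (suc L ℕ.+ i , L))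
  ∑∈-children m L σ F = ⊕-cong (≋-refl {F (L , σ)}) (∑∈-applyUpTo (λ i → (suc L ℕ.+ i , L)) (m ∸ L) F)

  children-max : ∀ t {m L σ} → L ≤ m →
                 (t ⊕ ⊝ 𝟙) ⊗ ∑∈ (children m (L , σ)) (λ (L′ , _) → t ^ L′) ≋ t ^ suc m ⊕ ⊝ (t ^ L)
  children-max t {m} {L} {σ} L≤m = begin
    (t ⊕ ⊝ 𝟙) ⊗ ∑∈ (children m (L , σ)) (λ (L′ , _) → t ^ L′)
      ≈⟨ ⊗-cong (≋-refl {t ⊕ ⊝ 𝟙}) (≋-trans (∑∈-children m L σ (λ (L′ , _) → t ^ L′))
                                             (⊕-cong (≋-refl {t ^ L}) (≋-trans (∑<-cong k (λ i _ → raise i)) (∑<-⊗ˡ k (t ^ L) (λ i → t ^ suc i))))) ⟩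
    (t ⊕ ⊝ 𝟙) ⊗ (t ^ L ⊕ t ^ L ⊗ ∑< k (λ i → t ^ suc i))
      ≈⟨ solve 3 (λ t a s → (t :- con (+ 1)) :* (a :+ a :* s) := a :* ((t :- con (+ 1)) :* (con (+ 1) :+ s))) ≋-refl t (t ^ L) (∑< k (λ i → t ^ suc i)) ⟩
    t ^ L ⊗ ((t ⊕ ⊝ 𝟙) ⊗ ∑< (suc k) (t ^_))
      ≈⟨ ⊗-cong (≋-refl {t ^ L}) (geometric-sum t (suc k)) ⟩
    t ^ L ⊗ (t ^ suc k ⊕ ⊝ 𝟙)
      ≈⟨ solve 2 (λ a b → a :* (b :- con (+ 1)) := a :* b :- a) ≋-refl (t ^ L) (t ^ suc k) ⟩
    t ^ L ⊗ t ^ suc k ⊕ ⊝ (t ^ L)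
      ≈⟨ ⊕-cong (≋-trans (≋-sym (^-homo-* t L (suc k))) (^-congʳ t (trans (ℕP.+-suc L k) (cong suc (ℕP.m+[n∸m]≡n L≤m)))))
                (≋-refl {⊝ (t ^ L)}) ⟩
    t ^ suc m ⊕ ⊝ (t ^ L) ∎
    where
    k : ℕ
    k = m ∸ L
    raise : ∀ i → t ^ (suc L ℕ.+ i) ≋ t ^ L ⊗ t ^ suc i
    raise i = ≋-trans (^-congʳ t (sym (ℕP.+-suc L i))) (^-homo-* t L (suc i))

  maxPowers-rec : ∀ t m → (t ⊕ ⊝ 𝟙) ⊗ maxPowers t (suc m) ≋ κ (+ labelCount m) ⊗ t ^ suc m ⊕ ⊝ maxPowers t m
  maxPowers-rec t m = begin
    (t ⊕ ⊝ 𝟙) ⊗ maxPowers t (suc m)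
      ≈⟨ ⊗-cong (≋-refl {t ⊕ ⊝ 𝟙}) (∑∈-concatMap (children m) (labels m) (λ (L , _) → t ^ L)) ⟩
    (t ⊕ ⊝ 𝟙) ⊗ ∑∈ (labels m) (λ p → ∑∈ (children m p) (λ (L , _) → t ^ L))
      ≈⟨ ≋-sym (∑∈-⊗ˡ (labels m) (t ⊕ ⊝ 𝟙) (λ p → ∑∈ (children m p) (λ (L , _) → t ^ L))) ⟩
    ∑∈ (labels m) (λ p → (t ⊕ ⊝ 𝟙) ⊗ ∑∈ (children m p) (λ (L , _) → t ^ L))
      ≈⟨ ∑∈-cong _ (λ (L , _) → t ^ suc m ⊕ ⊝ (t ^ L)) (labels-valid m) (λ {(L , σ)} (_ , L≤m) → children-max t {m} {L} {σ} L≤m) ⟩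
    ∑∈ (labels m) (λ (L , _) → t ^ suc m ⊕ ⊝ (t ^ L))
      ≈⟨ ∑∈-⊕ (labels m) (λ _ → t ^ suc m) (λ (L , _) → ⊝ (t ^ L)) ⟩
    ∑∈ (labels m) (λ _ → t ^ suc m) ⊕ ∑∈ (labels m) (λ (L , _) → ⊝ (t ^ L))
      ≈⟨ ⊕-cong (∑∈-const (labels m) (t ^ suc m)) (∑∈-⊝ (labels m) (λ (L , _) → t ^ L)) ⟩
    κ (+ labelCount m) ⊗ t ^ suc m ⊕ ⊝ maxPowers t m ∎

  secondPowers-rec : ∀ t m → secondPowers t (suc m) ≋ secondPowers t m ⊕ gapPowers t m
  secondPowers-rec t m = begin
    secondPowers t (suc m)
      ≈⟨ ∑∈-concatMap (children m) (labels m) (λ (_ , σ) → t ^ σ) ⟩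
    ∑∈ (labels m) (λ p → ∑∈ (children m p) (λ (_ , σ) → t ^ σ))
      ≈⟨ ∑∈-cong _ (λ (L , σ) → t ^ σ ⊕ κ (+ (m ∸ L)) ⊗ t ^ L) (labels-valid m) (λ {(L , σ)} _ → children-second L σ) ⟩
    ∑∈ (labels m) (λ (L , σ) → t ^ σ ⊕ κ (+ (m ∸ L)) ⊗ t ^ L)
      ≈⟨ ∑∈-⊕ (labels m) (λ (_ , σ) → t ^ σ) (λ (L , _) → κ (+ (m ∸ L)) ⊗ t ^ L) ⟩
    secondPowers t m ⊕ gapPowers t m ∎
    where
    children-second : ∀ L σ → ∑∈ (children m (L , σ)) (λ (_ , σ′) → t ^ σ′) ≋ t ^ σ ⊕ κ (+ (m ∸ L)) ⊗ t ^ L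
    children-second L σ = ≋-trans (∑∈-children m L σ (λ (_ , σ′) → t ^ σ′)) (⊕-cong (≋-refl {t ^ σ}) (∑<-const (m ∸ L) (t ^ L)))

  weightedGeometric : Series → ℕ → Series
  weightedGeometric t k = ∑< (suc k) (λ j → κ (+ (suc k ∸ j)) ⊗ t ^ j)

  weightedGeometric-closed : ∀ t k → (t ⊕ ⊝ 𝟙) ⊗ (t ⊕ ⊝ 𝟙) ⊗ weightedGeometric t k
                                     ≋ t ^ suc (suc k) ⊕ ⊝ t ⊕ ⊝ (κ (+ suc k) ⊗ (t ⊕ ⊝ 𝟙))
  weightedGeometric-closed t zero = begin
    (t ⊕ ⊝ 𝟙) ⊗ (t ⊕ ⊝ 𝟙) ⊗ (κ (+ 1) ⊗ 𝟙 ⊕ 𝟘)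
      ≈⟨ ⊗-cong (≋-refl {(t ⊕ ⊝ 𝟙) ⊗ (t ⊕ ⊝ 𝟙)}) (⊕-identityʳ (κ (+ 1) ⊗ 𝟙)) ⟩
    (t ⊕ ⊝ 𝟙) ⊗ (t ⊕ ⊝ 𝟙) ⊗ (κ (+ 1) ⊗ 𝟙)
      ≈⟨ solve 1 (λ t → (t :- con (+ 1)) :* (t :- con (+ 1)) :* (con (+ 1) :* con (+ 1))
                        := t :* (t :* con (+ 1)) :- t :- con (+ 1) :* (t :- con (+ 1))) ≋-refl t ⟩
    t ^ 2 ⊕ ⊝ t ⊕ ⊝ (κ (+ 1) ⊗ (t ⊕ ⊝ 𝟙)) ∎
  weightedGeometric-closed t (suc k) = begin
    (t ⊕ ⊝ 𝟙) ⊗ (t ⊕ ⊝ 𝟙) ⊗ weightedGeometric t (suc k)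
      ≈⟨ ⊗-cong (≋-refl {(t ⊕ ⊝ 𝟙) ⊗ (t ⊕ ⊝ 𝟙)}) unfold ⟩
    (t ⊕ ⊝ 𝟙) ⊗ (t ⊕ ⊝ 𝟙) ⊗ ((𝟙 ⊕ c) ⊗ 𝟙 ⊕ t ⊗ weightedGeometric t k)
      ≈⟨ solve 3 (λ t c w → (t :- con (+ 1)) :* (t :- con (+ 1)) :* ((con (+ 1) :+ c) :* con (+ 1) :+ t :* w)
                            := (t :- con (+ 1)) :* (t :- con (+ 1)) :* (con (+ 1) :+ c) :+ t :* ((t :- con (+ 1)) :* (t :- con (+ 1)) :* w))
               ≋-refl t c (weightedGeometric t k) ⟩
    (t ⊕ ⊝ 𝟙) ⊗ (t ⊕ ⊝ 𝟙) ⊗ (𝟙 ⊕ c) ⊕ t ⊗ ((t ⊕ ⊝ 𝟙) ⊗ (t ⊕ ⊝ 𝟙) ⊗ weightedGeometric t k)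
      ≈⟨ ⊕-cong (≋-refl {(t ⊕ ⊝ 𝟙) ⊗ (t ⊕ ⊝ 𝟙) ⊗ (𝟙 ⊕ c)}) (⊗-cong (≋-refl {t}) (weightedGeometric-closed t k)) ⟩
    (t ⊕ ⊝ 𝟙) ⊗ (t ⊕ ⊝ 𝟙) ⊗ (𝟙 ⊕ c) ⊕ t ⊗ (t ^ suc (suc k) ⊕ ⊝ t ⊕ ⊝ (c ⊗ (t ⊕ ⊝ 𝟙)))
      ≈⟨ solve 3 (λ t c p → (t :- con (+ 1)) :* (t :- con (+ 1)) :* (con (+ 1) :+ c) :+ t :* (p :- t :- c :* (t :- con (+ 1)))
                            := t :* p :- t :- (con (+ 1) :+ c) :* (t :- con (+ 1)))
               ≋-refl t c (t ^ suc (suc k)) ⟩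
    t ^ suc (suc (suc k)) ⊕ ⊝ t ⊕ ⊝ ((𝟙 ⊕ c) ⊗ (t ⊕ ⊝ 𝟙))
      ≈⟨ ⊕-cong (≋-refl {t ^ suc (suc (suc k)) ⊕ ⊝ t}) (⊝-cong (⊗-cong (≋-sym (κ-⊕ (+ 1) (+ suc k))) (≋-refl {t ⊕ ⊝ 𝟙}))) ⟩
    t ^ suc (suc (suc k)) ⊕ ⊝ t ⊕ ⊝ (κ (+ suc (suc k)) ⊗ (t ⊕ ⊝ 𝟙)) ∎
    where
    c : Series
    c = κ (+ suc k)
    unfold : weightedGeometric t (suc k) ≋ (𝟙 ⊕ c) ⊗ 𝟙 ⊕ t ⊗ weightedGeometric t k
    unfold = ⊕-cong (⊗-cong (κ-⊕ (+ 1) (+ suc k)) (≋-refl {𝟙}))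
                    (≋-trans (∑<-cong (suc k) (λ j _ → solve 3 (λ c t p → c :* (t :* p) := t :* (c :* p)) ≋-refl (κ (+ (suc k ∸ j))) t (t ^ j)))
                             (∑<-⊗ˡ (suc k) t (λ j → κ (+ (suc k ∸ j)) ⊗ t ^ j)))

  children-gap : ∀ t {m L σ} → L ≤ m →
    ∑∈ (children m (L , σ)) (λ (L′ , _) → κ (+ (suc m ∸ L′)) ⊗ t ^ L′) ≋ t ^ L ⊗ weightedGeometric t (m ∸ L)
  children-gap t {m} {L} {σ} L≤m = begin
    ∑∈ (children m (L , σ)) (λ (L′ , _) → κ (+ (suc m ∸ L′)) ⊗ t ^ L′)
      ≈⟨ ∑∈-children m L σ (λ (L′ , _) → κ (+ (suc m ∸ L′)) ⊗ t ^ L′) ⟩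
    κ (+ (suc m ∸ L)) ⊗ t ^ L ⊕ ∑< k (λ i → κ (+ (m ∸ (L ℕ.+ i))) ⊗ t ^ (suc L ℕ.+ i))
      ≈⟨ ⊕-cong (solve 2 (λ c p → c :* p := p :* (c :* con (+ 1))) ≋-refl (κ (+ (suc m ∸ L))) (t ^ L))
                (≋-trans (∑<-cong k (λ i _ → raise i)) (∑<-⊗ˡ k (t ^ L) (λ i → κ (+ (k ∸ i)) ⊗ t ^ suc i))) ⟩
    t ^ L ⊗ (κ (+ (suc m ∸ L)) ⊗ 𝟙) ⊕ t ^ L ⊗ ∑< k (λ i → κ (+ (k ∸ i)) ⊗ t ^ suc i)
      ≈⟨ ≋-sym (⊗-distribˡ-⊕ (t ^ L) _ _) ⟩
    t ^ L ⊗ (κ (+ (suc m ∸ L)) ⊗ 𝟙 ⊕ ∑< k (λ i → κ (+ (k ∸ i)) ⊗ t ^ suc i))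
      ≡⟨ cong (λ j → t ^ L ⊗ (κ (+ j) ⊗ 𝟙 ⊕ ∑< k (λ i → κ (+ (k ∸ i)) ⊗ t ^ suc i))) (ℕP.+-∸-assoc 1 L≤m) ⟩
    t ^ L ⊗ weightedGeometric t k ∎
    where
    k : ℕ
    k = m ∸ L
    raise : ∀ i → κ (+ (m ∸ (L ℕ.+ i))) ⊗ t ^ (suc L ℕ.+ i) ≋ t ^ L ⊗ (κ (+ (k ∸ i)) ⊗ t ^ suc i)
    raise i = begin
      κ (+ (m ∸ (L ℕ.+ i))) ⊗ t ^ (suc L ℕ.+ i)
        ≡⟨ cong (λ j → κ (+ j) ⊗ t ^ (suc L ℕ.+ i)) (ℕP.∸-+-assoc m L i) ⟨
      κ (+ (k ∸ i)) ⊗ t ^ (suc L ℕ.+ i)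
        ≈⟨ ⊗-cong (≋-refl {κ (+ (k ∸ i))}) (≋-trans (^-congʳ t (sym (ℕP.+-suc L i))) (^-homo-* t L (suc i))) ⟩
      κ (+ (k ∸ i)) ⊗ (t ^ L ⊗ t ^ suc i)
        ≈⟨ solve 3 (λ c a p → c :* (a :* p) := a :* (c :* p)) ≋-refl (κ (+ (k ∸ i))) (t ^ L) (t ^ suc i) ⟩
      t ^ L ⊗ (κ (+ (k ∸ i)) ⊗ t ^ suc i)         ∎

  gapPowers-rec : ∀ t m → (t ⊕ ⊝ 𝟙) ⊗ (t ⊕ ⊝ 𝟙) ⊗ gapPowers t (suc m)
                          ⊕ ((t ⊕ ⊝ 𝟙) ⊗ (gapPowers t m ⊕ maxPowers t m) ⊕ t ⊗ maxPowers t m)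
                          ≋ κ (+ labelCount m) ⊗ t ^ suc (suc m)
  gapPowers-rec t m = begin
    d² ⊗ gapPowers t (suc m) ⊕ R
      ≈⟨ ⊕-cong (≋-trans (⊗-cong (≋-refl {d²}) (∑∈-concatMap (children m) (labels m) (λ (L , _) → κ (+ (suc m ∸ L)) ⊗ t ^ L)))
                         (≋-sym (∑∈-⊗ˡ (labels m) d² (λ p → ∑∈ (children m p) (λ (L , _) → κ (+ (suc m ∸ L)) ⊗ t ^ L)))))
                (≋-refl {R}) ⟩
    ∑∈ (labels m) (λ p → d² ⊗ ∑∈ (children m p) (λ (L , _) → κ (+ (suc m ∸ L)) ⊗ t ^ L)) ⊕ R
      ≈⟨ ⊕-cong (∑∈-cong _ (λ (L , _) → t ^ suc (suc m) ⊕ ⊝ lower L) (labels-valid m) (λ {(L , σ)} (_ , L≤m) → per-label {L} {σ} L≤m)) (≋-refl {R}) ⟩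
    ∑∈ (labels m) (λ (L , _) → t ^ suc (suc m) ⊕ ⊝ lower L) ⊕ R
      ≈⟨ ⊕-cong (≋-trans (∑∈-⊕ (labels m) (λ _ → t ^ suc (suc m)) (λ (L , _) → ⊝ lower L))
                         (⊕-cong (∑∈-const (labels m) (t ^ suc (suc m))) (≋-trans (∑∈-⊝ (labels m) (λ (L , _) → lower L)) (⊝-cong lowers))))
                (≋-refl {R}) ⟩
    κ (+ labelCount m) ⊗ t ^ suc (suc m) ⊕ ⊝ R ⊕ R
      ≈⟨ solve 2 (λ a r → a :- r :+ r := a) ≋-refl (κ (+ labelCount m) ⊗ t ^ suc (suc m)) R ⟩
    κ (+ labelCount m) ⊗ t ^ suc (suc m) ∎
    where
    d d² R : Series
    d  = t ⊕ ⊝ 𝟙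
    d² = d ⊗ d
    R  = d ⊗ (gapPowers t m ⊕ maxPowers t m) ⊕ t ⊗ maxPowers t m
    lower : ℕ → Series
    lower L = d ⊗ (κ (+ (m ∸ L)) ⊗ t ^ L ⊕ t ^ L) ⊕ t ⊗ t ^ L
    per-label : ∀ {L σ} → L ≤ m →
                d² ⊗ ∑∈ (children m (L , σ)) (λ (L′ , _) → κ (+ (suc m ∸ L′)) ⊗ t ^ L′) ≋ t ^ suc (suc m) ⊕ ⊝ lower L
    per-label {L} {σ} L≤m = begin
      d² ⊗ ∑∈ (children m (L , σ)) (λ (L′ , _) → κ (+ (suc m ∸ L′)) ⊗ t ^ L′)
        ≈⟨ ⊗-cong (≋-refl {d²}) (children-gap t {m} {L} {σ} L≤m) ⟩
      d² ⊗ (t ^ L ⊗ weightedGeometric t (m ∸ L))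
        ≈⟨ solve 3 (λ e a w → e :* (a :* w) := a :* (e :* w)) ≋-refl d² (t ^ L) (weightedGeometric t (m ∸ L)) ⟩
      t ^ L ⊗ (d² ⊗ weightedGeometric t (m ∸ L))
        ≈⟨ ⊗-cong (≋-refl {t ^ L}) (≋-trans (weightedGeometric-closed t (m ∸ L))
                                            (⊕-cong (≋-refl {t ^ suc (suc (m ∸ L)) ⊕ ⊝ t}) (⊝-cong (⊗-cong (κ-⊕ (+ 1) (+ (m ∸ L))) (≋-refl {d}))))) ⟩
      t ^ L ⊗ (t ^ suc (suc (m ∸ L)) ⊕ ⊝ t ⊕ ⊝ ((𝟙 ⊕ κ (+ (m ∸ L))) ⊗ d))
        ≈⟨ solve 5 (λ a p t c d → a :* (p :- t :- (con (+ 1) :+ c) :* d) := a :* p :- (d :* (c :* a :+ a) :+ t :* a))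
                 ≋-refl (t ^ L) (t ^ suc (suc (m ∸ L))) t (κ (+ (m ∸ L))) d ⟩
      t ^ L ⊗ t ^ suc (suc (m ∸ L)) ⊕ ⊝ lower L
        ≈⟨ ⊕-cong (≋-trans (≋-sym (^-homo-* t L (suc (suc (m ∸ L)))))
                           (^-congʳ t (trans (ℕP.+-suc L (suc (m ∸ L))) (cong suc (trans (ℕP.+-suc L (m ∸ L)) (cong suc (ℕP.m+[n∸m]≡n L≤m)))))))
                  (≋-refl {⊝ lower L}) ⟩
      t ^ suc (suc m) ⊕ ⊝ lower L ∎
    lowers : ∑∈ (labels m) (λ (L , _) → lower L) ≋ R
    lowers = begin
      ∑∈ (labels m) (λ (L , _) → lower L)
        ≈⟨ ∑∈-⊕ (labels m) (λ (L , _) → d ⊗ (κ (+ (m ∸ L)) ⊗ t ^ L ⊕ t ^ L)) (λ (L , _) → t ⊗ t ^ L) ⟩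
      ∑∈ (labels m) (λ (L , _) → d ⊗ (κ (+ (m ∸ L)) ⊗ t ^ L ⊕ t ^ L)) ⊕ ∑∈ (labels m) (λ (L , _) → t ⊗ t ^ L)
        ≈⟨ ⊕-cong (≋-trans (∑∈-⊗ˡ (labels m) d (λ (L , _) → κ (+ (m ∸ L)) ⊗ t ^ L ⊕ t ^ L))
                           (⊗-cong (≋-refl {d}) (∑∈-⊕ (labels m) (λ (L , _) → κ (+ (m ∸ L)) ⊗ t ^ L) (λ (L , _) → t ^ L))))
                  (∑∈-⊗ˡ (labels m) t (λ (L , _) → t ^ L)) ⟩
      R ∎

module FunctionalEquations where

  open PowerSeries
  open Automaton using (sumℤ-applyUpTo)
  open CompletionSeries
  open KernelIdentities
  open import Data.Nat as ℕ using (ℕ; zero; suc; _∸_)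
  open import Data.Integer as ℤ using (ℤ; +_; -_)
  import Data.Integer.Properties as ℤP
  open import Data.List using (List; []; _∷_)
  open import Function using (_∘_)
  open import Relation.Binary.PropositionalEquality using (_≡_; refl; sym; trans; cong)
  open import Relation.Binary.Reasoning.Setoid ≋-setoid
  open SeriesSolver using (solve; _:=_; _:+_; _:*_; :-_; _:-_; con)

  C : ℕ → ℤ
  C m = + labelCount m

  maxPowers-zero : ∀ t → maxPowers t 0 ≋ 𝟙
  maxPowers-zero t = ⊕-identityʳ 𝟙

  maxPowers-equation : ∀ t → (t ⊕ ⊝ 𝟙 ⊕ X) ⊗ ∑Xᵐ (maxPowers t) ≋ (t ⊕ ⊝ 𝟙) ⊕ X ⊗ (t ⊗ (C ∘X· t))
  maxPowers-equation t = begin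
    (d ⊕ X) ⊗ M
      ≈⟨ ⊗-cong (≋-refl {d ⊕ X}) M-shift ⟩
    (d ⊕ X) ⊗ (𝟙 ⊕ X ⊗ M′)
      ≈⟨ solve 3 (λ d x m′ → (d :+ x) :* (con (+ 1) :+ x :* m′) := d :+ x :* (d :* m′) :+ x :* (con (+ 1) :+ x :* m′))
               ≋-refl d X M′ ⟩
    d ⊕ X ⊗ (d ⊗ M′) ⊕ X ⊗ (𝟙 ⊕ X ⊗ M′)
      ≈⟨ ⊕-cong (⊕-cong (≋-refl {d}) (⊗-cong (≋-refl {X}) d⊗M′)) (⊗-cong (≋-refl {X}) (≋-sym M-shift)) ⟩
    d ⊕ X ⊗ (t ⊗ (C ∘X· t) ⊕ ⊝ M) ⊕ X ⊗ M
      ≈⟨ solve 4 (λ d x c m → d :+ x :* (c :- m) :+ x :* m := d :+ x :* c) ≋-refl d X (t ⊗ (C ∘X· t)) M ⟩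
    d ⊕ X ⊗ (t ⊗ (C ∘X· t)) ∎
    where
    d M M′ : Series
    d  = t ⊕ ⊝ 𝟙
    M  = ∑Xᵐ (maxPowers t)
    M′ = ∑Xᵐ (maxPowers t ∘ suc)
    M-shift : M ≋ 𝟙 ⊕ X ⊗ M′
    M-shift = ≋-trans (∑Xᵐ-shift (maxPowers t)) (⊕-cong (maxPowers-zero t) (≋-refl {X ⊗ M′}))
    d⊗M′ : d ⊗ M′ ≋ t ⊗ (C ∘X· t) ⊕ ⊝ M
    d⊗M′ = begin
      d ⊗ M′
        ≈⟨ ≋-sym (∑Xᵐ-⊗ˡ d (maxPowers t ∘ suc)) ⟩
      ∑Xᵐ (λ m → d ⊗ maxPowers t (suc m))
        ≈⟨ ∑Xᵐ-cong (maxPowers-rec t) ⟩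
      ∑Xᵐ (λ m → κ (C m) ⊗ t ^ suc m ⊕ ⊝ maxPowers t m)
        ≈⟨ ∑Xᵐ-⊕ (λ m → κ (C m) ⊗ t ^ suc m) (λ m → ⊝ maxPowers t m) ⟩
      ∑Xᵐ (λ m → κ (C m) ⊗ (t ⊗ t ^ m)) ⊕ ∑Xᵐ (λ m → ⊝ maxPowers t m)
        ≈⟨ ⊕-cong (≋-trans (∑Xᵐ-cong (λ m → solve 3 (λ c t p → c :* (t :* p) := t :* (c :* p)) ≋-refl (κ (C m)) t (t ^ m)))
                           (∑Xᵐ-⊗ˡ t (λ m → κ (C m) ⊗ t ^ m)))
                  (∑Xᵐ-⊝ (maxPowers t)) ⟩
      t ⊗ (C ∘X· t) ⊕ ⊝ M ∎

  g : Series
  g = C ∘X· 1+X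

  P-equation : P ⊕ P ≋ 𝟙 ⊕ 1+X ⊗ g
  P-equation = X⊗-injective (begin
    X ⊗ (P ⊕ P)
      ≈⟨ solve 2 (λ x p → x :* (p :+ p) := ((con (+ 1) :+ x) :- con (+ 1) :+ x) :* p) ≋-refl X P ⟩
    (1+X ⊕ ⊝ 𝟙 ⊕ X) ⊗ P
      ≈⟨ maxPowers-equation 1+X ⟩
    (1+X ⊕ ⊝ 𝟙) ⊕ X ⊗ (1+X ⊗ g)
      ≈⟨ solve 2 (λ x v → ((con (+ 1) :+ x) :- con (+ 1)) :+ x :* v := x :* (con (+ 1) :+ v)) ≋-refl X (1+X ⊗ g) ⟩
    X ⊗ (𝟙 ⊕ 1+X ⊗ g)                   ∎)

  -- At t = 1 - X the left-hand side of maxPowers-equation vanishes, which pins down C(X(1-X)).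
  C[X[1-X]] : 1-X ⊗ (C ∘X· 1-X) ≋ 𝟙
  C[X[1-X]] = X⊗-injective (begin
    X ⊗ (1-X ⊗ h)                           ≈⟨ solve 2 (λ x h → x :* ((con (+ 1) :- x) :* h)
                                                                 := ((con (+ 1) :- x) :- con (+ 1)) :+ x :* ((con (+ 1) :- x) :* h) :+ x)
                                                     ≋-refl X h ⟩
    (1-X ⊕ ⊝ 𝟙) ⊕ X ⊗ (1-X ⊗ h) ⊕ X         ≈⟨ ⊕-cong (≋-sym (maxPowers-equation 1-X)) (≋-refl {X}) ⟩
    (1-X ⊕ ⊝ 𝟙 ⊕ X) ⊗ M ⊕ X                 ≈⟨ solve 2 (λ x m → ((con (+ 1) :- x) :- con (+ 1) :+ x) :* m :+ x := x :* con (+ 1))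
                                                     ≋-refl X M ⟩
    X ⊗ 𝟙                                   ∎)
    where
    h M : Series
    h = C ∘X· 1-X
    M = ∑Xᵐ (maxPowers 1-X)

  catalan : ∀ m → C (suc m) ≡ (C ⊗ C) m
  catalan = ∘X·-injective {1-X} {1/[1-X]} 1/[1-X]-inverse (C ∘ suc) (C ⊗ C) tail≋square
    where
    h Y : Series
    h = C ∘X· 1-X
    Y = (C ∘ suc) ∘X· 1-X
    h≋[1-X]Y : h ≋ 1-X ⊗ Y
    h≋[1-X]Y = X⊗-injective (⊕-cancelˡ 𝟙 _ _ (begin
      𝟙 ⊕ X ⊗ h                  ≈⟨ ⊕-cong (≋-sym C[X[1-X]]) (≋-refl {X ⊗ h}) ⟩
      1-X ⊗ h ⊕ X ⊗ h            ≈⟨ solve 2 (λ x h → (con (+ 1) :- x) :* h :+ x :* h := h) ≋-refl X h ⟩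
      h                          ≈⟨ ∘X·-shift C 1-X ⟩
      𝟙 ⊕ X ⊗ (1-X ⊗ Y)          ∎))
    tail≋square : Y ≋ (C ⊗ C) ∘X· 1-X
    tail≋square = begin
      Y                          ≈⟨ solve 1 (λ y → y := con (+ 1) :* y) ≋-refl Y ⟩
      𝟙 ⊗ Y                      ≈⟨ ⊗-cong (≋-sym C[X[1-X]]) (≋-refl {Y}) ⟩
      (1-X ⊗ h) ⊗ Y              ≈⟨ solve 3 (λ v h y → (v :* h) :* y := h :* (v :* y)) ≋-refl 1-X h Y ⟩
      h ⊗ (1-X ⊗ Y)              ≈⟨ ⊗-cong (≋-refl {h}) (≋-sym h≋[1-X]Y) ⟩
      h ⊗ h                      ≈⟨ ∘X·-⊗ C C 1-X ⟩
      (C ⊗ C) ∘X· 1-X            ∎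

  g-equation : g ≋ 𝟙 ⊕ X ⊗ (1+X ⊗ (g ⊗ g))
  g-equation = begin
    g                                        ≈⟨ ∘X·-shift C 1+X ⟩
    𝟙 ⊕ X ⊗ (1+X ⊗ ((C ∘ suc) ∘X· 1+X))     ≈⟨ ⊕-cong (≋-refl {𝟙}) (⊗-cong (≋-refl {X}) (⊗-cong (≋-refl {1+X})
                                                         (≋-trans (∘X·-cong 1+X catalan) (≋-sym (∘X·-⊗ C C 1+X))))) ⟩
    𝟙 ⊕ X ⊗ (1+X ⊗ (g ⊗ g))                  ∎

  B : Series
  B = ∑Xᵐ (gapPowers 1+X)

  Q-equation : Q ≋ 𝟙 ⊕ X ⊗ (Q ⊕ B)
  Q-equation = begin
    Q
      ≈⟨ ∑Xᵐ-shift (secondPowers 1+X) ⟩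
    secondPowers 1+X 0 ⊕ X ⊗ ∑Xᵐ (secondPowers 1+X ∘ suc)
      ≈⟨ ⊕-cong (⊕-identityʳ 𝟙) (⊗-cong (≋-refl {X})
                  (≋-trans (∑Xᵐ-cong (secondPowers-rec 1+X)) (∑Xᵐ-⊕ (secondPowers 1+X) (gapPowers 1+X)))) ⟩
    𝟙 ⊕ X ⊗ (Q ⊕ B) ∎

  B-equation : X ⊗ B ⊕ (X ⊗ (B ⊕ P) ⊕ 1+X ⊗ P) ≋ 1+X ⊗ 1+X ⊗ g
  B-equation = begin
    X ⊗ B ⊕ (X ⊗ (B ⊕ P) ⊕ 1+X ⊗ P)
      ≈⟨ ⊕-cong (⊗-cong (≋-refl {X}) B-shift) (≋-refl {X ⊗ (B ⊕ P) ⊕ 1+X ⊗ P}) ⟩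
    X ⊗ (X ⊗ B′) ⊕ (X ⊗ (B ⊕ P) ⊕ 1+X ⊗ P)
      ≈⟨ solve 4 (λ x b′ b p → x :* (x :* b′) :+ (x :* (b :+ p) :+ (con (+ 1) :+ x) :* p)
                               := ((con (+ 1) :+ x) :- con (+ 1)) :* ((con (+ 1) :+ x) :- con (+ 1)) :* b′
                                  :+ (((con (+ 1) :+ x) :- con (+ 1)) :* (b :+ p) :+ (con (+ 1) :+ x) :* p))
               ≋-refl X B′ B P ⟩
    d ⊗ d ⊗ B′ ⊕ (d ⊗ (B ⊕ P) ⊕ 1+X ⊗ P)
      ≈⟨ ≋-sym summed ⟩
    ∑Xᵐ (λ m → d ⊗ d ⊗ gapPowers 1+X (suc m) ⊕ rest m)
      ≈⟨ ∑Xᵐ-cong (gapPowers-rec 1+X) ⟩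
    ∑Xᵐ (λ m → κ (C m) ⊗ 1+X ^ suc (suc m))
      ≈⟨ ≋-trans (∑Xᵐ-cong (λ m → solve 3 (λ c u p → c :* (u :* (u :* p)) := (u :* u) :* (c :* p)) ≋-refl (κ (C m)) 1+X (1+X ^ m)))
                 (∑Xᵐ-⊗ˡ (1+X ⊗ 1+X) (λ m → κ (C m) ⊗ 1+X ^ m)) ⟩
    1+X ⊗ 1+X ⊗ g ∎
    where
    d B′ : Series
    d  = 1+X ⊕ ⊝ 𝟙
    B′ = ∑Xᵐ (gapPowers 1+X ∘ suc)
    B-shift : B ≋ X ⊗ B′
    B-shift = ≋-trans (∑Xᵐ-shift (gapPowers 1+X))
                      (λ n → trans (cong (ℤ._+ (X ⊗ B′) n) (trans (ℤP.+-identityʳ _) (κ⊗ (+ 0) 𝟙 n))) (ℤP.+-identityˡ _))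
    rest : ℕ → Series
    rest m = d ⊗ (gapPowers 1+X m ⊕ maxPowers 1+X m) ⊕ 1+X ⊗ maxPowers 1+X m
    summed : ∑Xᵐ (λ m → d ⊗ d ⊗ gapPowers 1+X (suc m) ⊕ rest m) ≋ d ⊗ d ⊗ B′ ⊕ (d ⊗ (B ⊕ P) ⊕ 1+X ⊗ P)
    summed = begin
      ∑Xᵐ (λ m → d ⊗ d ⊗ gapPowers 1+X (suc m) ⊕ rest m)
        ≈⟨ ∑Xᵐ-⊕ (λ m → d ⊗ d ⊗ gapPowers 1+X (suc m)) rest ⟩
      ∑Xᵐ (λ m → d ⊗ d ⊗ gapPowers 1+X (suc m)) ⊕ ∑Xᵐ rest
        ≈⟨ ⊕-cong (∑Xᵐ-⊗ˡ (d ⊗ d) (gapPowers 1+X ∘ suc))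
                  (≋-trans (∑Xᵐ-⊕ (λ m → d ⊗ (gapPowers 1+X m ⊕ maxPowers 1+X m)) (λ m → 1+X ⊗ maxPowers 1+X m))
                           (⊕-cong (≋-trans (∑Xᵐ-⊗ˡ d (λ m → gapPowers 1+X m ⊕ maxPowers 1+X m))
                                            (⊗-cong (≋-refl {d}) (∑Xᵐ-⊕ (gapPowers 1+X) (maxPowers 1+X))))
                                   (∑Xᵐ-⊗ˡ 1+X (maxPowers 1+X)))) ⟩
      d ⊗ d ⊗ B′ ⊕ (d ⊗ (B ⊕ P) ⊕ 1+X ⊗ P) ∎

  S : Series
  S = 𝟙 ⊕ ⊝ (κ (+ 2) ⊗ X ⊗ 1+X ⊗ g)

  horner : List ℤ → Series
  horner []       = κ (+ 0)
  horner (c ∷ cs) = κ c ⊕ X ⊗ horner cs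

  poly≋horner : ∀ cs → poly cs ≋ horner cs
  poly≋horner []       zero    = refl
  poly≋horner []       (suc n) = refl
  poly≋horner (c ∷ cs) zero    = sym (ℤP.+-identityʳ c)
  poly≋horner (c ∷ cs) (suc n) = trans (poly≋horner cs n) (sym (κ⊕X⊗-suc c (horner cs) n))

  ⊛≡⊗ : ∀ f g n → (f ⊛ g) n ≡ (f ⊗ g) n
  ⊛≡⊗ f g n = sumℤ-applyUpTo (λ i → f i ℤ.* g (n ∸ i)) (λ i → i) (suc n)

  S-squared : S ⊗ S ≋ horner (+ 1 ∷ - (+ 4) ∷ - (+ 4) ∷ [])
  S-squared = begin
    S ⊗ S
      ≈⟨ solve 2 (λ x g → (con (+ 1) :- con (+ 2) :* x :* (con (+ 1) :+ x) :* g) :* (con (+ 1) :- con (+ 2) :* x :* (con (+ 1) :+ x) :* g)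
                          := con (+ 1) :- con (+ 4) :* x :* (con (+ 1) :+ x) :* g
                             :+ con (+ 4) :* x :* (con (+ 1) :+ x) :* (x :* ((con (+ 1) :+ x) :* (g :* g))))
               ≋-refl X g ⟩
    𝟙 ⊕ ⊝ (κ (+ 4) ⊗ X ⊗ 1+X ⊗ g) ⊕ κ (+ 4) ⊗ X ⊗ 1+X ⊗ (X ⊗ (1+X ⊗ (g ⊗ g)))
      ≈⟨ ⊕-cong (≋-refl {𝟙 ⊕ ⊝ (κ (+ 4) ⊗ X ⊗ 1+X ⊗ g)}) (⊗-cong (≋-refl {κ (+ 4) ⊗ X ⊗ 1+X}) g-equation′) ⟩
    𝟙 ⊕ ⊝ (κ (+ 4) ⊗ X ⊗ 1+X ⊗ g) ⊕ κ (+ 4) ⊗ X ⊗ 1+X ⊗ (g ⊕ ⊝ 𝟙)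
      ≈⟨ solve 2 (λ x g → con (+ 1) :- con (+ 4) :* x :* (con (+ 1) :+ x) :* g :+ con (+ 4) :* x :* (con (+ 1) :+ x) :* (g :- con (+ 1))
                          := con (+ 1) :+ x :* (con (- (+ 4)) :+ x :* (con (- (+ 4)) :+ x :* con (+ 0))))
               ≋-refl X g ⟩
    horner (+ 1 ∷ - (+ 4) ∷ - (+ 4) ∷ []) ∎
    where
    g-equation′ : X ⊗ (1+X ⊗ (g ⊗ g)) ≋ g ⊕ ⊝ 𝟙
    g-equation′ = ≋-trans (solve 1 (λ t → t := (con (+ 1) :+ t) :- con (+ 1)) ≋-refl (X ⊗ (1+X ⊗ (g ⊗ g))))
                          (⊕-cong (≋-sym g-equation) (≋-refl {⊝ 𝟙}))

  [1-X]Q : 1-X ⊗ Q ≋ 𝟙 ⊕ X ⊗ B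
  [1-X]Q = begin
    1-X ⊗ Q
      ≈⟨ solve 2 (λ x q → (con (+ 1) :- x) :* q := q :- x :* q) ≋-refl X Q ⟩
    Q ⊕ ⊝ (X ⊗ Q)
      ≈⟨ ⊕-cong Q-equation (≋-refl {⊝ (X ⊗ Q)}) ⟩
    𝟙 ⊕ X ⊗ (Q ⊕ B) ⊕ ⊝ (X ⊗ Q)
      ≈⟨ solve 3 (λ x q b → con (+ 1) :+ x :* (q :+ b) :- x :* q := con (+ 1) :+ x :* b) ≋-refl X Q B ⟩
    𝟙 ⊕ X ⊗ B                        ∎

  2XB : X ⊗ B ⊕ X ⊗ B ≋ 1+X ⊗ 1+X ⊗ g ⊕ ⊝ ((𝟙 ⊕ κ (+ 2) ⊗ X) ⊗ P)
  2XB = begin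
    X ⊗ B ⊕ X ⊗ B
      ≈⟨ solve 3 (λ x b p → x :* b :+ x :* b := (x :* b :+ (x :* (b :+ p) :+ (con (+ 1) :+ x) :* p)) :- (con (+ 1) :+ con (+ 2) :* x) :* p)
               ≋-refl X B P ⟩
    (X ⊗ B ⊕ (X ⊗ (B ⊕ P) ⊕ 1+X ⊗ P)) ⊕ ⊝ ((𝟙 ⊕ κ (+ 2) ⊗ X) ⊗ P)
      ≈⟨ ⊕-cong B-equation (≋-refl {⊝ ((𝟙 ⊕ κ (+ 2) ⊗ X) ⊗ P)}) ⟩
    1+X ⊗ 1+X ⊗ g ⊕ ⊝ ((𝟙 ⊕ κ (+ 2) ⊗ X) ⊗ P) ∎

  -- Eliminating Q, B and P in turn, the four functional equations leave only g.
  F-closed-form : horner (+ 0 ∷ + 8 ∷ - (+ 16) ∷ + 8 ∷ []) ⊗ F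
                  ≋ horner (+ 2 ∷ + 1 ∷ - (+ 10) ∷ + 4 ∷ []) ⊕ ⊝ (horner (+ 2 ∷ - (+ 3) ∷ []) ⊗ S)
  F-closed-form = begin
    horner (+ 0 ∷ + 8 ∷ - (+ 16) ∷ + 8 ∷ []) ⊗ F
      ≈⟨ solve 2 (λ x f → (con (+ 0) :+ x :* (con (+ 8) :+ x :* (con (- (+ 16)) :+ x :* (con (+ 8) :+ x :* con (+ 0))))) :* f
                          := con (+ 8) :* x :* (con (+ 1) :- x) :* ((con (+ 1) :- x) :* f))
               ≋-refl X F ⟩
    c₁ ⊗ (1-X ⊗ F)
      ≈⟨ ⊗-cong (≋-refl {c₁}) F-equation ⟩
    c₁ ⊗ (P ⊕ ⊝ (X ⊗ Q))
      ≈⟨ solve 3 (λ x p q → con (+ 8) :* x :* (con (+ 1) :- x) :* (p :- x :* q)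
                            := con (+ 8) :* x :* (con (+ 1) :- x) :* p :- con (+ 8) :* x :* x :* ((con (+ 1) :- x) :* q))
               ≋-refl X P Q ⟩
    c₁ ⊗ P ⊕ ⊝ (c₂ ⊗ (1-X ⊗ Q))
      ≈⟨ ⊕-cong (≋-refl {c₁ ⊗ P}) (⊝-cong (⊗-cong (≋-refl {c₂}) [1-X]Q)) ⟩
    c₁ ⊗ P ⊕ ⊝ (c₂ ⊗ (𝟙 ⊕ X ⊗ B))
      ≈⟨ solve 3 (λ x p b → con (+ 8) :* x :* (con (+ 1) :- x) :* p :- con (+ 8) :* x :* x :* (con (+ 1) :+ x :* b)
                            := con (+ 8) :* x :* (con (+ 1) :- x) :* p :- con (+ 8) :* x :* x :- con (+ 4) :* x :* x :* (x :* b :+ x :* b))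
               ≋-refl X P B ⟩
    c₁ ⊗ P ⊕ ⊝ c₂ ⊕ ⊝ (c₃ ⊗ (X ⊗ B ⊕ X ⊗ B))
      ≈⟨ ⊕-cong (≋-refl {c₁ ⊗ P ⊕ ⊝ c₂}) (⊝-cong (⊗-cong (≋-refl {c₃}) 2XB)) ⟩
    c₁ ⊗ P ⊕ ⊝ c₂ ⊕ ⊝ (c₃ ⊗ (1+X ⊗ 1+X ⊗ g ⊕ ⊝ ((𝟙 ⊕ κ (+ 2) ⊗ X) ⊗ P)))
      ≈⟨ solve 3 (λ x p g → con (+ 8) :* x :* (con (+ 1) :- x) :* p :- con (+ 8) :* x :* x
                               :- con (+ 4) :* x :* x :* ((con (+ 1) :+ x) :* (con (+ 1) :+ x) :* g :- (con (+ 1) :+ con (+ 2) :* x) :* p)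
                            := (con (+ 4) :* x :- con (+ 2) :* x :* x :+ con (+ 4) :* x :* x :* x) :* (p :+ p)
                               :- con (+ 8) :* x :* x :- con (+ 4) :* x :* x :* (con (+ 1) :+ x) :* (con (+ 1) :+ x) :* g)
               ≋-refl X P g ⟩
    c₄ ⊗ (P ⊕ P) ⊕ ⊝ c₂ ⊕ ⊝ (c₃ ⊗ 1+X ⊗ 1+X ⊗ g)
      ≈⟨ ⊕-cong (⊕-cong (⊗-cong (≋-refl {c₄}) P-equation) (≋-refl {⊝ c₂})) (≋-refl {⊝ (c₃ ⊗ 1+X ⊗ 1+X ⊗ g)}) ⟩
    c₄ ⊗ (𝟙 ⊕ 1+X ⊗ g) ⊕ ⊝ c₂ ⊕ ⊝ (c₃ ⊗ 1+X ⊗ 1+X ⊗ g)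
      ≈⟨ solve 2 (λ x g → (con (+ 4) :* x :- con (+ 2) :* x :* x :+ con (+ 4) :* x :* x :* x) :* (con (+ 1) :+ (con (+ 1) :+ x) :* g)
                             :- con (+ 8) :* x :* x :- con (+ 4) :* x :* x :* (con (+ 1) :+ x) :* (con (+ 1) :+ x) :* g
                          := (con (+ 2) :+ x :* (con (+ 1) :+ x :* (con (- (+ 10)) :+ x :* (con (+ 4) :+ x :* con (+ 0)))))
                             :- (con (+ 2) :+ x :* (con (- (+ 3)) :+ x :* con (+ 0))) :* (con (+ 1) :- con (+ 2) :* x :* (con (+ 1) :+ x) :* g))
               ≋-refl X g ⟩
    horner (+ 2 ∷ + 1 ∷ - (+ 10) ∷ + 4 ∷ []) ⊕ ⊝ (horner (+ 2 ∷ - (+ 3) ∷ []) ⊗ S) ∎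
    where
    c₁ c₂ c₃ c₄ : Series
    c₁ = κ (+ 8) ⊗ X ⊗ 1-X
    c₂ = κ (+ 8) ⊗ X ⊗ X
    c₃ = κ (+ 4) ⊗ X ⊗ X
    c₄ = κ (+ 4) ⊗ X ⊕ ⊝ (κ (+ 2) ⊗ X ⊗ X) ⊕ κ (+ 4) ⊗ X ⊗ X ⊗ X


open import Data.Product using (_,_)
open import Relation.Binary.PropositionalEquality using (refl; sym; trans; cong₂; module ≡-Reasoning)
open PowerSeries using (_⊗_; ⊗-cong; ≋-refl)
open FunctionalEquations

mainTheorem1 : Σ (ℕ → ℤ) (λ S →
    (S 0 ≡ + 1)
  × ((∀ n → (S ⊛ S) n ≡ poly (+ 1 ∷ - (+ 4) ∷ - (+ 4) ∷ []) n)
  × (∀ n → (poly (+ 0 ∷ + 8 ∷ - (+ 16) ∷ + 8 ∷ []) ⊛ F) n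
           ≡ poly (+ 2 ∷ + 1 ∷ - (+ 10) ∷ + 4 ∷ []) n - (poly (+ 2 ∷ - (+ 3) ∷ []) ⊛ S) n)))
mainTheorem1 = S , refl , square , closed-form
  where
  open ≡-Reasoning
  8X[1-X]² 2-3X : List ℤ
  8X[1-X]² = + 0 ∷ + 8 ∷ - (+ 16) ∷ + 8 ∷ []
  2-3X     = + 2 ∷ - (+ 3) ∷ []
  square : ∀ n → (S ⊛ S) n ≡ poly (+ 1 ∷ - (+ 4) ∷ - (+ 4) ∷ []) n
  square n = trans (⊛≡⊗ S S n) (trans (S-squared n) (sym (poly≋horner (+ 1 ∷ - (+ 4) ∷ - (+ 4) ∷ []) n)))
  closed-form : ∀ n → (poly (+ 0 ∷ + 8 ∷ - (+ 16) ∷ + 8 ∷ []) ⊛ F) n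
                      ≡ poly (+ 2 ∷ + 1 ∷ - (+ 10) ∷ + 4 ∷ []) n - (poly (+ 2 ∷ - (+ 3) ∷ []) ⊛ S) n
  closed-form n = begin
    (poly (+ 0 ∷ + 8 ∷ - (+ 16) ∷ + 8 ∷ []) ⊛ F) n
      ≡⟨ ⊛≡⊗ (poly 8X[1-X]²) F n ⟩
    (poly (+ 0 ∷ + 8 ∷ - (+ 16) ∷ + 8 ∷ []) ⊗ F) n
      ≡⟨ ⊗-cong (poly≋horner 8X[1-X]²) (≋-refl {F}) n ⟩
    (horner (+ 0 ∷ + 8 ∷ - (+ 16) ∷ + 8 ∷ []) ⊗ F) n
      ≡⟨ F-closed-form n ⟩
    horner (+ 2 ∷ + 1 ∷ - (+ 10) ∷ + 4 ∷ []) n - (horner (+ 2 ∷ - (+ 3) ∷ []) ⊗ S) n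
      ≡⟨ cong₂ _-_ (sym (poly≋horner (+ 2 ∷ + 1 ∷ - (+ 10) ∷ + 4 ∷ []) n))
                   (sym (trans (⊛≡⊗ (poly 2-3X) S n) (⊗-cong (poly≋horner 2-3X) (≋-refl {S}) n))) ⟩
    poly (+ 2 ∷ + 1 ∷ - (+ 10) ∷ + 4 ∷ []) n - (poly (+ 2 ∷ - (+ 3) ∷ []) ⊛ S) n ∎
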